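{- For $n\ge1$, $$\sum_{\pi\in\mathfrak{S}_n(45312,45321,54312,54321)}p^{\mathrm{rlmin}(\pi)}=\sum_{\pi\in\mathfrak{S}_n(31245,32145,31254,32154)}p^{\mathrm{rlmax}(\pi)}.$$ In particular $|\mathfrak{S}_n(45312,45321,54312,54321)|=|\mathfrak{S}_n(31245,32145,31254,32154)|$.
   Context: $\mathfrak{S}_n(\dots)$ denotes permutations of $[n]$ avoiding the listed patterns. $\mathrm{rlmin}(\pi)$ is the number of entries of $\pi$ smaller than all entries to their right; $\mathrm{rlmax}(\pi)$ is the number of entries larger than all entries to their right. -}

module Defs where

open import Data.Nat using (ℕ; zero; suc; _+_; _<ᵇ_; _≡ᵇ_)
open import Data.Bool using (Bool; true; false; _∧_; not; if_then_else_)
open import Data.List using (List; []; _∷_; map; concatMap; length; filterᵇ)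
open import Data.Bool.ListAction using (all; any)

-- Permutations of [n] = {1,…,n} in one-line notation, as lists of naturals.
-- insertions x l : all ways of inserting x into l.
insertions : ℕ → List ℕ → List (List ℕ)
insertions x [] = (x ∷ []) ∷ []
insertions x (y ∷ ys) = (x ∷ y ∷ ys) ∷ map (y ∷_) (insertions x ys)

perms : ℕ → List (List ℕ)
perms zero = [] ∷ []
perms (suc n) = concatMap (insertions (suc n)) (perms n)

subseqs : List ℕ → List (List ℕ)
subseqs [] = [] ∷ []
subseqs (x ∷ xs) = map (x ∷_) (subseqs xs) ++' subseqs xs
  where
  _++'_ : List (List ℕ) → List (List ℕ) → List (List ℕ)
  [] ++' ys = ys
  (z ∷ zs) ++' ys = z ∷ (zs ++' ys)

_⇔ᵇ_ : Bool → Bool → Bool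
true ⇔ᵇ b = b
false ⇔ᵇ b = not b

orderIso : List ℕ → List ℕ → Bool
orderIso [] [] = true
orderIso (a ∷ as) (b ∷ bs) = pairs as bs ∧ orderIso as bs
  where
  pairs : List ℕ → List ℕ → Bool
  pairs [] [] = true
  pairs (x ∷ xs) (y ∷ ys) = ((a <ᵇ x) ⇔ᵇ (b <ᵇ y)) ∧ ((x <ᵇ a) ⇔ᵇ (y <ᵇ b)) ∧ pairs xs ys
  pairs _ _ = false
orderIso _ _ = false

contains : List ℕ → List ℕ → Bool
contains π σ = any (λ s → orderIso s σ) (subseqs π)

avoidsAll : List (List ℕ) → List ℕ → Bool
avoidsAll pats π = not (any (contains π) pats)

Av : ℕ → List (List ℕ) → List (List ℕ)
Av n pats = filterᵇ (avoidsAll pats) (perms n)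

rlmin : List ℕ → ℕ
rlmin [] = 0
rlmin (x ∷ xs) = (if all (x <ᵇ_) xs then 1 else 0) + rlmin xs

rlmax : List ℕ → ℕ
rlmax [] = 0
rlmax (x ∷ xs) = (if all (_<ᵇ x) xs then 1 else 0) + rlmax xs

-- coefficient of p^k in  Σ_{π ∈ S} p^{stat π}
coeff : (List ℕ → ℕ) → List (List ℕ) → ℕ → ℕ
coeff stat S k = length (filterᵇ (λ π → stat π ≡ᵇ k) S)

pats₁ : List (List ℕ)
pats₁ = (4 ∷ 5 ∷ 3 ∷ 1 ∷ 2 ∷ []) ∷ (4 ∷ 5 ∷ 3 ∷ 2 ∷ 1 ∷ []) ∷ (5 ∷ 4 ∷ 3 ∷ 1 ∷ 2 ∷ []) ∷ (5 ∷ 4 ∷ 3 ∷ 2 ∷ 1 ∷ []) ∷ []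

pats₂ : List (List ℕ)
pats₂ = (3 ∷ 1 ∷ 2 ∷ 4 ∷ 5 ∷ []) ∷ (3 ∷ 2 ∷ 1 ∷ 4 ∷ 5 ∷ []) ∷ (3 ∷ 1 ∷ 2 ∷ 5 ∷ 4 ∷ []) ∷ (3 ∷ 2 ∷ 1 ∷ 5 ∷ 4 ∷ []) ∷ []

{-# OPTIONS --safe #-}
module Submission where

-- Complementing values, x ↦ n + 1 − x, maps 𝔖ₙ(45312, 45321, 54312, 54321) onto
-- 𝔖ₙ(21354, 21345, 12354, 12345) (class A below) and turns right-to-left minima into
-- right-to-left maxima, so it suffices to compare rlmax on class A and on
-- 𝔖ₙ(31245, 32145, 31254, 32154) (class B). A permutation lies outside A (resp. B) iff
-- it has an occurrence of a shape τ, two distinct entries below a later one (resp. below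
-- an earlier one), followed by two entries above the shape. Both classes are generated
-- by inserting a new maximum into the gaps of a smaller member. The admissible gaps form
-- an initial segment [0, K), and what a child inherits is governed by a threshold U, the
-- longest prefix free of τ: inserting at gap g yields labels (K + 1, grow U g) when g ≤ U
-- and (U + 1, U) otherwise. The two rules grow differ, but both satisfy the summation
-- identity Σ-Q-grow, so in both trees the number of descendants at depth d with k
-- right-to-left maxima is the same treeCount, starting from the same root 1.

open import Defs
open import Data.Nat
open import Data.Nat.Properties
open import Algebra.Properties.CommutativeSemigroup +-commutativeSemigroup using () renaming (interchange to +-interchange)
open import Data.Bool using (Bool; true; false; _∧_; _∨_; not; if_then_else_; T; T?)
open import Data.Bool.Properties using (∧-zeroʳ)
open import Data.Bool.ListAction using (any; all)
import Data.List as List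
open import Data.List using (List; []; _∷_; _++_; [_]; map; length; take; drop; concatMap; filterᵇ)
open import Data.List.Properties using (∷-injective; drop-drop; concatMap-cong; concatMap-pure; length-++; ++-assoc; take++drop≡id; length-drop; length-take; filter-++; concatMap-++; ++-identityʳ)
open import Data.List.Membership.Propositional using (_∈_; find; lose)
open import Data.List.Membership.Propositional.Properties using (∈-map⁻; ∈-map⁺; ∈-∃++; ∈-concatMap⁺; ∈-concatMap⁻)
open import Data.List.Membership.Propositional.Properties.WithK using (unique∧set⇒bag)
open import Data.List.Relation.Unary.All as All using (All; []; _∷_)
open import Data.List.Relation.Unary.All.Properties using (++⁺; drop⁺; take⁺; filter⁺) renaming (map⁺ to All-map⁺)
open import Data.List.Relation.Unary.Any using (here; there)
open import Data.List.Relation.Unary.AllPairs using (AllPairs; []; _∷_)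
open import Data.List.Relation.Unary.Unique.Propositional using (Unique)
import Data.List.Relation.Unary.Unique.Propositional.Properties as UP
open import Data.List.Relation.Binary.Disjoint.Propositional using (Disjoint)
open import Data.List.Relation.Binary.BagAndSetEquality using (∼bag⇒↭)
open import Data.List.Relation.Binary.Permutation.Propositional using (_↭_; ↭-sym; ↭-trans; ↭-refl; prep; swap)
open import Data.List.Relation.Binary.Permutation.Propositional.Properties using (drop-mid; ∈-resp-↭; ↭-empty-inv; map⁺; ++-comm; filter-↭; ↭-length)
open import Data.Product using (Σ; _,_; proj₁; proj₂; _×_)
open import Data.Sum using (_⊎_; inj₁; inj₂)
open import Data.Empty using (⊥; ⊥-elim)
open import Function.Base using (_∘_)
open import Function.Bundles using (mk⇔)
open import Relation.Nullary using (¬_)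
open import Relation.Binary.Definitions using (tri<; tri≈; tri>)
open import Relation.Binary.PropositionalEquality hiding ([_])
open ≡-Reasoning

-- The append local to subseqs cannot be named from here; it is recovered as the
-- solution of a metavariable, by unifying with the unfolding of subseqs. The cons is
-- qualified so that the abstracted term is not elaborated as an overloaded constructor.
mutual
  subseqs-append : ℕ → List ℕ → List (List ℕ) → List (List ℕ) → List (List ℕ)
  subseqs-append = _

  subseqs-∷-append : ∀ x xs → subseqs (x ∷ xs) ≡ subseqs-append x xs (map (List._∷_ x) (subseqs xs)) (subseqs xs)
  subseqs-∷-append x xs with map (List._∷_ x) (subseqs xs)
  ... | heads with subseqs xs
  ... | tails = refl

subseqs-append≡++ : ∀ x xs ws ys → subseqs-append x xs ws ys ≡ ws ++ ys
subseqs-append≡++ x xs [] ys = refl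
subseqs-append≡++ x xs (w ∷ ws) ys = cong (w ∷_) (subseqs-append≡++ x xs ws ys)

subseqs-∷ : ∀ x xs → subseqs (x ∷ xs) ≡ map (x ∷_) (subseqs xs) ++ subseqs xs
subseqs-∷ x xs = trans (subseqs-∷-append x xs) (subseqs-append≡++ x xs (map (x ∷_) (subseqs xs)) (subseqs xs))

any-++ : ∀ {A : Set} (f : A → Bool) xs ys → any f (xs ++ ys) ≡ any f xs ∨ any f ys
any-++ f [] ys = refl
any-++ f (x ∷ xs) ys with f x
... | true = refl
... | false = any-++ f xs ys

any-map : ∀ {A B : Set} (f : B → Bool) (g : A → B) xs → any f (map g xs) ≡ any (λ x → f (g x)) xs
any-map f g [] = refl
any-map f g (x ∷ xs) = cong (f (g x) ∨_) (any-map f g xs)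

any-subseqs-∷ : ∀ (f : List ℕ → Bool) x xs → any f (subseqs (x ∷ xs)) ≡ any (λ s → f (x ∷ s)) (subseqs xs) ∨ any f (subseqs xs)
any-subseqs-∷ f x xs rewrite subseqs-∷ x xs | any-++ f (map (x ∷_) (subseqs xs)) (subseqs xs) | any-map f (x ∷_) (subseqs xs) = refl

∨-true⁻ : ∀ a b → a ∨ b ≡ true → a ≡ true ⊎ b ≡ true
∨-true⁻ true b _ = inj₁ refl
∨-true⁻ false b e = inj₂ e

∨-trueˡ : ∀ a b → a ≡ true → a ∨ b ≡ true
∨-trueˡ true b _ = refl

∨-trueʳ : ∀ a b → b ≡ true → a ∨ b ≡ true
∨-trueʳ true b _ = refl
∨-trueʳ false b e = e

∧-true⁻ : ∀ a b → a ∧ b ≡ true → a ≡ true × b ≡ true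
∧-true⁻ true true _ = refl , refl

data Sub : List ℕ → List ℕ → Set where
  sub[] : Sub [] []
  skip : ∀ {xs y ys} → Sub xs ys → Sub xs (y ∷ ys)
  keep : ∀ {x xs ys} → Sub xs ys → Sub (x ∷ xs) (x ∷ ys)

[]-Sub : ∀ ys → Sub [] ys
[]-Sub [] = sub[]
[]-Sub (y ∷ ys) = skip ([]-Sub ys)

any-subseqs⁻ : ∀ (f : List ℕ → Bool) l → any f (subseqs l) ≡ true → Σ (List ℕ) λ s → Sub s l × f s ≡ true
any-subseqs⁻ f [] e with f [] in eq
... | true = [] , sub[] , eq
any-subseqs⁻ f (x ∷ xs) e rewrite any-subseqs-∷ f x xs with ∨-true⁻ (any (λ s → f (x ∷ s)) (subseqs xs)) _ e
... | inj₁ e1 with any-subseqs⁻ (λ s → f (x ∷ s)) xs e1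
... | s , sb , fs = x ∷ s , keep sb , fs
any-subseqs⁻ f (x ∷ xs) e | inj₂ e2 with any-subseqs⁻ f xs e2
... | s , sb , fs = s , skip sb , fs

any-subseqs⁺ : ∀ (f : List ℕ → Bool) {s l} → Sub s l → f s ≡ true → any f (subseqs l) ≡ true
any-subseqs⁺ f sub[] e rewrite e = refl
any-subseqs⁺ f {s} {y ∷ ys} (skip sb) e rewrite any-subseqs-∷ f y ys = ∨-trueʳ _ _ (any-subseqs⁺ f sb e)
any-subseqs⁺ f {x ∷ s} {x ∷ ys} (keep sb) e rewrite any-subseqs-∷ f x ys = ∨-trueˡ _ _ (any-subseqs⁺ (λ t → f (x ∷ t)) sb e)

<⇒<ᵇ≡true : ∀ {m n} → m < n → (m <ᵇ n) ≡ true
<⇒<ᵇ≡true {zero} {suc n} _ = refl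
<⇒<ᵇ≡true {suc m} {suc n} (s≤s p) = <⇒<ᵇ≡true {m} {n} p

≤⇒<ᵇ≡false : ∀ {m n} → n ≤ m → (m <ᵇ n) ≡ false
≤⇒<ᵇ≡false {m} {zero} _ = refl
≤⇒<ᵇ≡false {suc m} {suc n} (s≤s p) = ≤⇒<ᵇ≡false {m} {n} p

<ᵇ≡true⇒< : ∀ {m n} → (m <ᵇ n) ≡ true → m < n
<ᵇ≡true⇒< {zero} {suc n} _ = s≤s z≤n
<ᵇ≡true⇒< {suc m} {suc n} e = s≤s (<ᵇ≡true⇒< e)

⇔ᵇ-true⁻ : ∀ p q → (p ⇔ᵇ q) ≡ true → p ≡ q
⇔ᵇ-true⁻ true true _ = refl
⇔ᵇ-true⁻ false false _ = refl

⇔ᵇ-refl : ∀ p → (p ⇔ᵇ p) ≡ true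
⇔ᵇ-refl true = refl
⇔ᵇ-refl false = refl

record SameOrder5 (a b c d e x1 x2 x3 x4 x5 : ℕ) : Set where
  field
    ab : (a <ᵇ b) ≡ (x1 <ᵇ x2)
    ba : (b <ᵇ a) ≡ (x2 <ᵇ x1)
    ac : (a <ᵇ c) ≡ (x1 <ᵇ x3)
    ca : (c <ᵇ a) ≡ (x3 <ᵇ x1)
    ad : (a <ᵇ d) ≡ (x1 <ᵇ x4)
    da : (d <ᵇ a) ≡ (x4 <ᵇ x1)
    ae : (a <ᵇ e) ≡ (x1 <ᵇ x5)
    ea : (e <ᵇ a) ≡ (x5 <ᵇ x1)
    bc : (b <ᵇ c) ≡ (x2 <ᵇ x3)
    cb : (c <ᵇ b) ≡ (x3 <ᵇ x2)
    bd : (b <ᵇ d) ≡ (x2 <ᵇ x4)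
    db : (d <ᵇ b) ≡ (x4 <ᵇ x2)
    be : (b <ᵇ e) ≡ (x2 <ᵇ x5)
    eb : (e <ᵇ b) ≡ (x5 <ᵇ x2)
    cd : (c <ᵇ d) ≡ (x3 <ᵇ x4)
    dc : (d <ᵇ c) ≡ (x4 <ᵇ x3)
    ce : (c <ᵇ e) ≡ (x3 <ᵇ x5)
    ec : (e <ᵇ c) ≡ (x5 <ᵇ x3)
    de : (d <ᵇ e) ≡ (x4 <ᵇ x5)
    ed : (e <ᵇ d) ≡ (x5 <ᵇ x4)

SameOrder5⇒orderIso : ∀ a b c d e x1 x2 x3 x4 x5 → SameOrder5 a b c d e x1 x2 x3 x4 x5 → orderIso (a ∷ b ∷ c ∷ d ∷ e ∷ []) (x1 ∷ x2 ∷ x3 ∷ x4 ∷ x5 ∷ []) ≡ true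
SameOrder5⇒orderIso a b c d e x1 x2 x3 x4 x5 o
  rewrite SameOrder5.ab o | SameOrder5.ba o | SameOrder5.ac o | SameOrder5.ca o | SameOrder5.ad o | SameOrder5.da o | SameOrder5.ae o | SameOrder5.ea o
        | SameOrder5.bc o | SameOrder5.cb o | SameOrder5.bd o | SameOrder5.db o | SameOrder5.be o | SameOrder5.eb o
        | SameOrder5.cd o | SameOrder5.dc o | SameOrder5.ce o | SameOrder5.ec o | SameOrder5.de o | SameOrder5.ed o
        | ⇔ᵇ-refl (x1 <ᵇ x2) | ⇔ᵇ-refl (x2 <ᵇ x1) | ⇔ᵇ-refl (x1 <ᵇ x3) | ⇔ᵇ-refl (x3 <ᵇ x1)
        | ⇔ᵇ-refl (x1 <ᵇ x4) | ⇔ᵇ-refl (x4 <ᵇ x1) | ⇔ᵇ-refl (x1 <ᵇ x5) | ⇔ᵇ-refl (x5 <ᵇ x1)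
        | ⇔ᵇ-refl (x2 <ᵇ x3) | ⇔ᵇ-refl (x3 <ᵇ x2) | ⇔ᵇ-refl (x2 <ᵇ x4) | ⇔ᵇ-refl (x4 <ᵇ x2)
        | ⇔ᵇ-refl (x2 <ᵇ x5) | ⇔ᵇ-refl (x5 <ᵇ x2) | ⇔ᵇ-refl (x3 <ᵇ x4) | ⇔ᵇ-refl (x4 <ᵇ x3)
        | ⇔ᵇ-refl (x3 <ᵇ x5) | ⇔ᵇ-refl (x5 <ᵇ x3) | ⇔ᵇ-refl (x4 <ᵇ x5) | ⇔ᵇ-refl (x5 <ᵇ x4) = refl

orderIso⇒SameOrder5 : ∀ a b c d e x1 x2 x3 x4 x5 → orderIso (a ∷ b ∷ c ∷ d ∷ e ∷ []) (x1 ∷ x2 ∷ x3 ∷ x4 ∷ x5 ∷ []) ≡ true → SameOrder5 a b c d e x1 x2 x3 x4 x5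
orderIso⇒SameOrder5 a b c d e x1 x2 x3 x4 x5 h = go
  where
  s1 = ∧-true⁻ _ _ h
  pa = proj₁ s1
  r1 = ∧-true⁻ _ _ (proj₂ s1)
  pb = proj₁ r1
  r2 = ∧-true⁻ _ _ (proj₂ r1)
  pc = proj₁ r2
  r3 = ∧-true⁻ _ _ (proj₂ r2)
  pd = proj₁ r3
  a1 = ∧-true⁻ _ _ pa
  a2 = ∧-true⁻ _ _ (proj₂ a1)
  a3 = ∧-true⁻ _ _ (proj₂ a2)
  a4 = ∧-true⁻ _ _ (proj₂ a3)
  a5 = ∧-true⁻ _ _ (proj₂ a4)
  a6 = ∧-true⁻ _ _ (proj₂ a5)
  a7 = ∧-true⁻ _ _ (proj₂ a6)
  a8 = ∧-true⁻ _ _ (proj₂ a7)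
  b1 = ∧-true⁻ _ _ pb
  b2 = ∧-true⁻ _ _ (proj₂ b1)
  b3 = ∧-true⁻ _ _ (proj₂ b2)
  b4 = ∧-true⁻ _ _ (proj₂ b3)
  b5 = ∧-true⁻ _ _ (proj₂ b4)
  b6 = ∧-true⁻ _ _ (proj₂ b5)
  c1 = ∧-true⁻ _ _ pc
  c2 = ∧-true⁻ _ _ (proj₂ c1)
  c3 = ∧-true⁻ _ _ (proj₂ c2)
  c4 = ∧-true⁻ _ _ (proj₂ c3)
  d1 = ∧-true⁻ _ _ pd
  d2 = ∧-true⁻ _ _ (proj₂ d1)
  go : SameOrder5 a b c d e x1 x2 x3 x4 x5
  go = record
    { ab = ⇔ᵇ-true⁻ _ _ (proj₁ a1) ; ba = ⇔ᵇ-true⁻ _ _ (proj₁ a2) ; ac = ⇔ᵇ-true⁻ _ _ (proj₁ a3) ; ca = ⇔ᵇ-true⁻ _ _ (proj₁ a4)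
    ; ad = ⇔ᵇ-true⁻ _ _ (proj₁ a5) ; da = ⇔ᵇ-true⁻ _ _ (proj₁ a6) ; ae = ⇔ᵇ-true⁻ _ _ (proj₁ a7) ; ea = ⇔ᵇ-true⁻ _ _ (proj₁ a8)
    ; bc = ⇔ᵇ-true⁻ _ _ (proj₁ b1) ; cb = ⇔ᵇ-true⁻ _ _ (proj₁ b2) ; bd = ⇔ᵇ-true⁻ _ _ (proj₁ b3) ; db = ⇔ᵇ-true⁻ _ _ (proj₁ b4)
    ; be = ⇔ᵇ-true⁻ _ _ (proj₁ b5) ; eb = ⇔ᵇ-true⁻ _ _ (proj₁ b6)
    ; cd = ⇔ᵇ-true⁻ _ _ (proj₁ c1) ; dc = ⇔ᵇ-true⁻ _ _ (proj₁ c2) ; ce = ⇔ᵇ-true⁻ _ _ (proj₁ c3) ; ec = ⇔ᵇ-true⁻ _ _ (proj₁ c4)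
    ; de = ⇔ᵇ-true⁻ _ _ (proj₁ d1) ; ed = ⇔ᵇ-true⁻ _ _ (proj₁ d2) }

data Index5 : ℕ → Set where
  j1 : Index5 1
  j2 : Index5 2
  j3 : Index5 3
  j4 : Index5 4
  j5 : Index5 5

module Increasing5 (v1 v2 v3 v4 v5 : ℕ) (h12 : v1 < v2) (h23 : v2 < v3) (h34 : v3 < v4) (h45 : v4 < v5) where
  V : ℕ → ℕ
  V 1 = v1
  V 2 = v2
  V 3 = v3
  V 4 = v4
  V 5 = v5
  V _ = 0

  h13 = <-trans h12 h23
  h14 = <-trans h13 h34
  h15 = <-trans h14 h45
  h24 = <-trans h23 h34
  h25 = <-trans h24 h45
  h35 = <-trans h34 h45

  V-<ᵇ : ∀ {i j} → Index5 i → Index5 j → (V i <ᵇ V j) ≡ (i <ᵇ j)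
  V-<ᵇ j1 j1 = ≤⇒<ᵇ≡false {v1} {v1} ≤-refl
  V-<ᵇ j1 j2 = <⇒<ᵇ≡true h12
  V-<ᵇ j1 j3 = <⇒<ᵇ≡true h13
  V-<ᵇ j1 j4 = <⇒<ᵇ≡true h14
  V-<ᵇ j1 j5 = <⇒<ᵇ≡true h15
  V-<ᵇ j2 j1 = ≤⇒<ᵇ≡false (<⇒≤ h12)
  V-<ᵇ j2 j2 = ≤⇒<ᵇ≡false {v2} {v2} ≤-refl
  V-<ᵇ j2 j3 = <⇒<ᵇ≡true h23
  V-<ᵇ j2 j4 = <⇒<ᵇ≡true h24
  V-<ᵇ j2 j5 = <⇒<ᵇ≡true h25
  V-<ᵇ j3 j1 = ≤⇒<ᵇ≡false (<⇒≤ h13)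
  V-<ᵇ j3 j2 = ≤⇒<ᵇ≡false (<⇒≤ h23)
  V-<ᵇ j3 j3 = ≤⇒<ᵇ≡false {v3} {v3} ≤-refl
  V-<ᵇ j3 j4 = <⇒<ᵇ≡true h34
  V-<ᵇ j3 j5 = <⇒<ᵇ≡true h35
  V-<ᵇ j4 j1 = ≤⇒<ᵇ≡false (<⇒≤ h14)
  V-<ᵇ j4 j2 = ≤⇒<ᵇ≡false (<⇒≤ h24)
  V-<ᵇ j4 j3 = ≤⇒<ᵇ≡false (<⇒≤ h34)
  V-<ᵇ j4 j4 = ≤⇒<ᵇ≡false {v4} {v4} ≤-refl
  V-<ᵇ j4 j5 = <⇒<ᵇ≡true h45
  V-<ᵇ j5 j1 = ≤⇒<ᵇ≡false (<⇒≤ h15)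
  V-<ᵇ j5 j2 = ≤⇒<ᵇ≡false (<⇒≤ h25)
  V-<ᵇ j5 j3 = ≤⇒<ᵇ≡false (<⇒≤ h35)
  V-<ᵇ j5 j4 = ≤⇒<ᵇ≡false (<⇒≤ h45)
  V-<ᵇ j5 j5 = ≤⇒<ᵇ≡false {v5} {v5} ≤-refl

  V-orderIso : ∀ {i1 i2 i3 i4 i5} → Index5 i1 → Index5 i2 → Index5 i3 → Index5 i4 → Index5 i5 →
        orderIso (V i1 ∷ V i2 ∷ V i3 ∷ V i4 ∷ V i5 ∷ []) (i1 ∷ i2 ∷ i3 ∷ i4 ∷ i5 ∷ []) ≡ true
  V-orderIso {i1} {i2} {i3} {i4} {i5} p1 p2 p3 p4 p5 = SameOrder5⇒orderIso (V i1) (V i2) (V i3) (V i4) (V i5) i1 i2 i3 i4 i5 (record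
    { ab = V-<ᵇ p1 p2 ; ba = V-<ᵇ p2 p1 ; ac = V-<ᵇ p1 p3 ; ca = V-<ᵇ p3 p1 ; ad = V-<ᵇ p1 p4 ; da = V-<ᵇ p4 p1
    ; ae = V-<ᵇ p1 p5 ; ea = V-<ᵇ p5 p1 ; bc = V-<ᵇ p2 p3 ; cb = V-<ᵇ p3 p2 ; bd = V-<ᵇ p2 p4 ; db = V-<ᵇ p4 p2
    ; be = V-<ᵇ p2 p5 ; eb = V-<ᵇ p5 p2 ; cd = V-<ᵇ p3 p4 ; dc = V-<ᵇ p4 p3 ; ce = V-<ᵇ p3 p5 ; ec = V-<ᵇ p5 p3
    ; de = V-<ᵇ p4 p5 ; ed = V-<ᵇ p5 p4 })

data Occ5 (P : ℕ → ℕ → ℕ → ℕ → ℕ → Set) (l : List ℕ) : Set where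
  occ5 : ∀ a b c d e → Sub (a ∷ b ∷ c ∷ d ∷ e ∷ []) l → P a b c d e → Occ5 P l

Decodes : (ℕ → ℕ → ℕ → ℕ → ℕ → Set) → List ℕ → Set
Decodes P σ = length σ ≡ 5 × (∀ a b c d e → orderIso (a ∷ b ∷ c ∷ d ∷ e ∷ []) σ ≡ true → P a b c d e)

decodes : ∀ {P} x₁ x₂ x₃ x₄ x₅ → (∀ {a b c d e} → SameOrder5 a b c d e x₁ x₂ x₃ x₄ x₅ → P a b c d e) →
  Decodes P (x₁ ∷ x₂ ∷ x₃ ∷ x₄ ∷ x₅ ∷ [])
decodes x₁ x₂ x₃ x₄ x₅ f = refl , λ a b c d e o → f (orderIso⇒SameOrder5 a b c d e x₁ x₂ x₃ x₄ x₅ o)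

orderIso-length : ∀ s σ → orderIso s σ ≡ true → length s ≡ length σ
orderIso-length [] [] _ = refl
orderIso-length (a ∷ as) (b ∷ bs) h with orderIso as bs in eq
... | true = cong suc (orderIso-length as bs eq)
... | false with trans (sym h) (∧-zeroʳ _)
... | ()

contains⇒Occ5 : ∀ {P σ} l → Decodes P σ → contains l σ ≡ true → Occ5 P l
contains⇒Occ5 {P} {σ} l (five , dec) h with any-subseqs⁻ (λ s → orderIso s σ) l h
... | s , sb , o = go s sb o (trans (orderIso-length s σ o) five)
  where
  go : ∀ s → Sub s l → orderIso s σ ≡ true → length s ≡ 5 → Occ5 P l
  go (a ∷ b ∷ c ∷ d ∷ e ∷ []) sb o refl = occ5 a b c d e sb (dec a b c d e o)

not-false⁻ : ∀ b → not b ≡ false → b ≡ true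
not-false⁻ true _ = refl

not-false : ∀ b → b ≡ true → not b ≡ false
not-false true _ = refl

avoidsAll-false⇒Occ5 : ∀ {P} pats l → All (Decodes P) pats → avoidsAll pats l ≡ false → Occ5 P l
avoidsAll-false⇒Occ5 pats l dec e = go pats dec (not-false⁻ _ e)
  where
  go : ∀ {P} pats → All (Decodes P) pats → any (contains l) pats ≡ true → Occ5 P l
  go (σ ∷ pats) (d ∷ ds) h with ∨-true⁻ (contains l σ) _ h
  ... | inj₁ hσ = contains⇒Occ5 l d hσ
  ... | inj₂ hs = go pats ds hs

any-∈ : ∀ {f : List ℕ → Bool} {σ pats} → σ ∈ pats → f σ ≡ true → any f pats ≡ true
any-∈ {f} (here refl) e = ∨-trueˡ (f _) _ e
any-∈ {f} (there m) e = ∨-trueʳ (f _) _ (any-∈ m e)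

occurrence⇒¬avoidsAll : ∀ {σ s l} pats → σ ∈ pats → Sub s l → orderIso s σ ≡ true → avoidsAll pats l ≡ false
occurrence⇒¬avoidsAll pats m sb o = not-false _ (any-∈ m (any-subseqs⁺ (λ t → orderIso t _) sb o))

Sem : (ℕ → ℕ → ℕ → Set) → (ℕ → ℕ → ℕ → ℕ) → ℕ → ℕ → ℕ → ℕ → ℕ → Set
Sem τ key a b c d e = τ a b c × key a b c < d × key a b c < e × d ≢ e

τA : ℕ → ℕ → ℕ → Set
τA a b c = a < c × b < c × a ≢ b

keyA : ℕ → ℕ → ℕ → ℕ
keyA a b c = c

τB : ℕ → ℕ → ℕ → Set
τB a b c = b < a × c < a × b ≢ c

keyB : ℕ → ℕ → ℕ → ℕ
keyB a b c = a

pats₁ᶜ : List (List ℕ)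
pats₁ᶜ = map (map (6 ∸_)) pats₁

Sem₁ : ℕ → ℕ → ℕ → ℕ → ℕ → Set
Sem₁ a b c d e = c < a × c < b × a ≢ b × d < c × e < c × d ≢ e

decodes₁ : All (Decodes Sem₁) pats₁
decodes₁ =
  decodes 4 5 3 1 2 (λ r → let open SameOrder5 r in <ᵇ≡true⇒< ca , <ᵇ≡true⇒< cb , <⇒≢ (<ᵇ≡true⇒< ab) , <ᵇ≡true⇒< dc , <ᵇ≡true⇒< ec , <⇒≢ (<ᵇ≡true⇒< de)) ∷
  decodes 4 5 3 2 1 (λ r → let open SameOrder5 r in <ᵇ≡true⇒< ca , <ᵇ≡true⇒< cb , <⇒≢ (<ᵇ≡true⇒< ab) , <ᵇ≡true⇒< dc , <ᵇ≡true⇒< ec , >⇒≢ (<ᵇ≡true⇒< ed)) ∷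
  decodes 5 4 3 1 2 (λ r → let open SameOrder5 r in <ᵇ≡true⇒< ca , <ᵇ≡true⇒< cb , >⇒≢ (<ᵇ≡true⇒< ba) , <ᵇ≡true⇒< dc , <ᵇ≡true⇒< ec , <⇒≢ (<ᵇ≡true⇒< de)) ∷
  decodes 5 4 3 2 1 (λ r → let open SameOrder5 r in <ᵇ≡true⇒< ca , <ᵇ≡true⇒< cb , >⇒≢ (<ᵇ≡true⇒< ba) , <ᵇ≡true⇒< dc , <ᵇ≡true⇒< ec , >⇒≢ (<ᵇ≡true⇒< ed)) ∷ []

decodesA : All (Decodes (Sem τA keyA)) pats₁ᶜ
decodesA =
  decodes 2 1 3 5 4 (λ r → let open SameOrder5 r in (<ᵇ≡true⇒< ac , <ᵇ≡true⇒< bc , >⇒≢ (<ᵇ≡true⇒< ba)) , <ᵇ≡true⇒< cd , <ᵇ≡true⇒< ce , >⇒≢ (<ᵇ≡true⇒< ed)) ∷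
  decodes 2 1 3 4 5 (λ r → let open SameOrder5 r in (<ᵇ≡true⇒< ac , <ᵇ≡true⇒< bc , >⇒≢ (<ᵇ≡true⇒< ba)) , <ᵇ≡true⇒< cd , <ᵇ≡true⇒< ce , <⇒≢ (<ᵇ≡true⇒< de)) ∷
  decodes 1 2 3 5 4 (λ r → let open SameOrder5 r in (<ᵇ≡true⇒< ac , <ᵇ≡true⇒< bc , <⇒≢ (<ᵇ≡true⇒< ab)) , <ᵇ≡true⇒< cd , <ᵇ≡true⇒< ce , >⇒≢ (<ᵇ≡true⇒< ed)) ∷
  decodes 1 2 3 4 5 (λ r → let open SameOrder5 r in (<ᵇ≡true⇒< ac , <ᵇ≡true⇒< bc , <⇒≢ (<ᵇ≡true⇒< ab)) , <ᵇ≡true⇒< cd , <ᵇ≡true⇒< ce , <⇒≢ (<ᵇ≡true⇒< de)) ∷ []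

decodesB : All (Decodes (Sem τB keyB)) pats₂
decodesB =
  decodes 3 1 2 4 5 (λ r → let open SameOrder5 r in (<ᵇ≡true⇒< ba , <ᵇ≡true⇒< ca , <⇒≢ (<ᵇ≡true⇒< bc)) , <ᵇ≡true⇒< ad , <ᵇ≡true⇒< ae , <⇒≢ (<ᵇ≡true⇒< de)) ∷
  decodes 3 2 1 4 5 (λ r → let open SameOrder5 r in (<ᵇ≡true⇒< ba , <ᵇ≡true⇒< ca , >⇒≢ (<ᵇ≡true⇒< cb)) , <ᵇ≡true⇒< ad , <ᵇ≡true⇒< ae , <⇒≢ (<ᵇ≡true⇒< de)) ∷
  decodes 3 1 2 5 4 (λ r → let open SameOrder5 r in (<ᵇ≡true⇒< ba , <ᵇ≡true⇒< ca , <⇒≢ (<ᵇ≡true⇒< bc)) , <ᵇ≡true⇒< ad , <ᵇ≡true⇒< ae , >⇒≢ (<ᵇ≡true⇒< ed)) ∷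
  decodes 3 2 1 5 4 (λ r → let open SameOrder5 r in (<ᵇ≡true⇒< ba , <ᵇ≡true⇒< ca , >⇒≢ (<ᵇ≡true⇒< cb)) , <ᵇ≡true⇒< ad , <ᵇ≡true⇒< ae , >⇒≢ (<ᵇ≡true⇒< ed)) ∷ []

Occ₁⇒¬avoids₁ : ∀ {l} → Occ5 Sem₁ l → avoidsAll pats₁ l ≡ false
Occ₁⇒¬avoids₁ (occ5 a b c d e sb (c<a , c<b , a≢b , d<c , e<c , d≢e)) with <-cmp a b | <-cmp d e
... | tri≈ _ a≡b _ | _ = ⊥-elim (a≢b a≡b)
... | _ | tri≈ _ d≡e _ = ⊥-elim (d≢e d≡e)
... | tri< a<b _ _ | tri< d<e _ _ = occurrence⇒¬avoidsAll pats₁ (here refl) sb (Increasing5.V-orderIso d e c a b d<e e<c c<a a<b j4 j5 j3 j1 j2)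
... | tri< a<b _ _ | tri> _ _ e<d = occurrence⇒¬avoidsAll pats₁ (there (here refl)) sb (Increasing5.V-orderIso e d c a b e<d d<c c<a a<b j4 j5 j3 j2 j1)
... | tri> _ _ b<a | tri< d<e _ _ = occurrence⇒¬avoidsAll pats₁ (there (there (here refl))) sb (Increasing5.V-orderIso d e c b a d<e e<c c<b b<a j5 j4 j3 j1 j2)
... | tri> _ _ b<a | tri> _ _ e<d = occurrence⇒¬avoidsAll pats₁ (there (there (there (here refl)))) sb (Increasing5.V-orderIso e d c b a e<d d<c c<b b<a j5 j4 j3 j2 j1)

OccA⇒¬avoidsA : ∀ {l} → Occ5 (Sem τA keyA) l → avoidsAll pats₁ᶜ l ≡ false
OccA⇒¬avoidsA (occ5 a b c d e sb ((a<c , b<c , a≢b) , c<d , c<e , d≢e)) with <-cmp a b | <-cmp d e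
... | tri≈ _ a≡b _ | _ = ⊥-elim (a≢b a≡b)
... | _ | tri≈ _ d≡e _ = ⊥-elim (d≢e d≡e)
... | tri> _ _ b<a | tri> _ _ e<d = occurrence⇒¬avoidsAll pats₁ᶜ (here refl) sb (Increasing5.V-orderIso b a c e d b<a a<c c<e e<d j2 j1 j3 j5 j4)
... | tri> _ _ b<a | tri< d<e _ _ = occurrence⇒¬avoidsAll pats₁ᶜ (there (here refl)) sb (Increasing5.V-orderIso b a c d e b<a a<c c<d d<e j2 j1 j3 j4 j5)
... | tri< a<b _ _ | tri> _ _ e<d = occurrence⇒¬avoidsAll pats₁ᶜ (there (there (here refl))) sb (Increasing5.V-orderIso a b c e d a<b b<c c<e e<d j1 j2 j3 j5 j4)
... | tri< a<b _ _ | tri< d<e _ _ = occurrence⇒¬avoidsAll pats₁ᶜ (there (there (there (here refl)))) sb (Increasing5.V-orderIso a b c d e a<b b<c c<d d<e j1 j2 j3 j4 j5)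

OccB⇒¬avoidsB : ∀ {l} → Occ5 (Sem τB keyB) l → avoidsAll pats₂ l ≡ false
OccB⇒¬avoidsB (occ5 a b c d e sb ((b<a , c<a , b≢c) , a<d , a<e , d≢e)) with <-cmp b c | <-cmp d e
... | tri≈ _ b≡c _ | _ = ⊥-elim (b≢c b≡c)
... | _ | tri≈ _ d≡e _ = ⊥-elim (d≢e d≡e)
... | tri< b<c _ _ | tri< d<e _ _ = occurrence⇒¬avoidsAll pats₂ (here refl) sb (Increasing5.V-orderIso b c a d e b<c c<a a<d d<e j3 j1 j2 j4 j5)
... | tri> _ _ c<b | tri< d<e _ _ = occurrence⇒¬avoidsAll pats₂ (there (here refl)) sb (Increasing5.V-orderIso c b a d e c<b b<a a<d d<e j3 j2 j1 j4 j5)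
... | tri< b<c _ _ | tri> _ _ e<d = occurrence⇒¬avoidsAll pats₂ (there (there (here refl))) sb (Increasing5.V-orderIso b c a e d b<c c<a a<e e<d j3 j1 j2 j5 j4)
... | tri> _ _ c<b | tri> _ _ e<d = occurrence⇒¬avoidsAll pats₂ (there (there (there (here refl)))) sb (Increasing5.V-orderIso c b a e d c<b b<a a<e e<d j3 j2 j1 j5 j4)

ins : ℕ → ℕ → List ℕ → List ℕ
ins zero N l = N ∷ l
ins (suc g) N [] = N ∷ []
ins (suc g) N (x ∷ l) = x ∷ ins g N l

ins≡take++drop : ∀ g N l → ins g N l ≡ take g l ++ N ∷ drop g l
ins≡take++drop zero N l = refl
ins≡take++drop (suc g) N [] = refl
ins≡take++drop (suc g) N (x ∷ l) = cong (x ∷_) (ins≡take++drop g N l)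

length-ins : ∀ g N l → length (ins g N l) ≡ suc (length l)
length-ins zero N l = refl
length-ins (suc g) N [] = refl
length-ins (suc g) N (x ∷ l) = cong suc (length-ins g N l)

Sub-ins : ∀ {s l} g N → Sub s l → Sub s (ins g N l)
Sub-ins zero N sb = skip sb
Sub-ins (suc g) N sub[] = skip sub[]
Sub-ins (suc g) N (skip sb) = skip (Sub-ins g N sb)
Sub-ins (suc g) N (keep sb) = keep (Sub-ins g N sb)

contains-ins : ∀ π σ g N → contains π σ ≡ true → contains (ins g N π) σ ≡ true
contains-ins π σ g N e with any-subseqs⁻ (λ s → orderIso s σ) π e
... | s , sb , o = any-subseqs⁺ (λ s → orderIso s σ) (Sub-ins g N sb) o

Sub-all : ∀ {P : ℕ → Set} {s l} → All P l → Sub s l → All P s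
Sub-all [] sub[] = []
Sub-all (_ ∷ a) (skip sb) = Sub-all a sb
Sub-all (p ∷ a) (keep sb) = p ∷ Sub-all a sb

Sub-++ : ∀ {xs P ys S} → Sub xs P → Sub ys S → Sub (xs ++ ys) (P ++ S)
Sub-++ sub[] s2 = s2
Sub-++ (skip s1) s2 = skip (Sub-++ s1 s2)
Sub-++ (keep s1) s2 = keep (Sub-++ s1 s2)

Sub-split : ∀ xs {ys L} → Sub (xs ++ ys) L → Σ (List ℕ) λ P → Σ (List ℕ) λ S → L ≡ P ++ S × Sub xs P × Sub ys S
Sub-split [] {L = L} sb = [] , L , refl , sub[] , sb
Sub-split (x ∷ xs) (skip {y = y} sb) with Sub-split (x ∷ xs) sb
... | P , S , e , s1 , s2 = y ∷ P , S , cong (y ∷_) e , skip s1 , s2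
Sub-split (x ∷ xs) (keep sb) with Sub-split xs sb
... | P , S , e , s1 , s2 = x ∷ P , S , cong (x ∷_) e , keep s1 , s2

Sub-trans : ∀ {a b c} → Sub a b → Sub b c → Sub a c
Sub-trans s1 sub[] = s1
Sub-trans s1 (skip s2) = skip (Sub-trans s1 s2)
Sub-trans (skip s1) (keep s2) = skip (Sub-trans s1 s2)
Sub-trans (keep s1) (keep s2) = keep (Sub-trans s1 s2)

Sub-mid : ∀ A {N B s} → Sub s (A ++ N ∷ B) → Sub s (A ++ B) ⊎ Σ (List ℕ) λ s1 → Σ (List ℕ) λ s2 → s ≡ s1 ++ N ∷ s2 × Sub s1 A × Sub s2 B
Sub-mid [] (skip sb) = inj₁ sb
Sub-mid [] {N} (keep {xs = s2} sb) = inj₂ ([] , s2 , refl , sub[] , sb)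
Sub-mid (x ∷ A) (skip sb) with Sub-mid A sb
... | inj₁ s = inj₁ (skip s)
... | inj₂ (s1 , s2 , e , a , b) = inj₂ (s1 , s2 , e , skip a , b)
Sub-mid (x ∷ A) (keep sb) with Sub-mid A sb
... | inj₁ s = inj₁ (keep s)
... | inj₂ (s1 , s2 , refl , a , b) = inj₂ (x ∷ s1 , s2 , refl , keep a , b)

Sub-take-++ : ∀ {s} P S m → length P ≤ m → Sub s P → Sub s (take m (P ++ S))
Sub-take-++ [] S m _ sub[] = []-Sub _
Sub-take-++ (x ∷ P) S (suc m) (s≤s p) (skip sb) = skip (Sub-take-++ P S m p sb)
Sub-take-++ (x ∷ P) S (suc m) (s≤s p) (keep sb) = keep (Sub-take-++ P S m p sb)

ins-++r : ∀ P S g N → length P ≤ g → ins g N (P ++ S) ≡ P ++ ins (g ∸ length P) N S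
ins-++r [] S g N _ = refl
ins-++r (x ∷ P) S (suc g) N (s≤s p) = cong (x ∷_) (ins-++r P S g N p)

ins-++l : ∀ P S g N → g ≤ length P → ins g N (P ++ S) ≡ ins g N P ++ S
ins-++l P S zero N _ = refl
ins-++l (x ∷ P) S (suc g) N (s≤s p) = cong (x ∷_) (ins-++l P S g N p)

max-Sub-ins : ∀ N j L → Sub (N ∷ []) (ins j N L)
max-Sub-ins N zero L = keep ([]-Sub L)
max-Sub-ins N (suc j) [] = keep sub[]
max-Sub-ins N (suc j) (x ∷ L) = skip (max-Sub-ins N j L)

Sub-pair-ins : ∀ {w} N j S → Sub (w ∷ []) S → Sub (w ∷ N ∷ []) (ins j N S) ⊎ Sub (N ∷ w ∷ []) (ins j N S)
Sub-pair-ins N zero S sb = inj₂ (keep sb)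
Sub-pair-ins N (suc j) (y ∷ S) (skip sb) with Sub-pair-ins N j S sb
... | inj₁ r = inj₁ (skip r)
... | inj₂ r = inj₂ (skip r)
Sub-pair-ins N (suc j) (y ∷ S) (keep sb) = inj₁ (keep (max-Sub-ins N j S))

++≡ins⁻ : ∀ P S g N l → g ≤ length l → P ++ S ≡ ins g N l →
  (length P ≤ g × Σ (List ℕ) λ S₀ → l ≡ P ++ S₀ × S ≡ ins (g ∸ length P) N S₀)
  ⊎ (g < length P × Σ (List ℕ) λ P₀ → l ≡ P₀ ++ S × P ≡ ins g N P₀)
++≡ins⁻ [] S g N l _ e = inj₁ (z≤n , l , refl , e)
++≡ins⁻ (p ∷ P) S zero N l _ refl = inj₂ (s≤s z≤n , P , refl , refl)
++≡ins⁻ (p ∷ P) S (suc g) N (x ∷ l) (s≤s gl) e with ∷-injective e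
... | refl , e2 with ++≡ins⁻ P S g N l gl e2
... | inj₁ (q , S₀ , e3 , e4) = inj₁ (s≤s q , S₀ , cong (p ∷_) e3 , e4)
... | inj₂ (q , P₀ , e3 , e4) = inj₂ (s≤s q , p ∷ P₀ , cong (p ∷_) e3 , cong (p ∷_) e4)

take-ins-≤ : ∀ g' g0 N l → g0 ≤ length l → g' ≤ g0 → take g' (ins g0 N l) ≡ take g' l
take-ins-≤ zero g0 N l _ _ = refl
take-ins-≤ (suc g') (suc g0) N (x ∷ l) (s≤s a) (s≤s b) = cong (x ∷_) (take-ins-≤ g' g0 N l a b)

take-ins-> : ∀ g' g0 N l → g0 ≤ length l → g0 < g' → take g' (ins g0 N l) ≡ ins g0 N (take (g' ∸ 1) l)
take-ins-> (suc g') zero N l _ _ = refl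
take-ins-> (suc (suc g')) (suc g0) N (x ∷ l) (s≤s a) (s≤s b) = cong (x ∷_) (take-ins-> (suc g') g0 N l a b)

drop-ins-≤ : ∀ g' g0 N l → g0 ≤ length l → g' ≤ g0 → drop g' (ins g0 N l) ≡ ins (g0 ∸ g') N (drop g' l)
drop-ins-≤ zero g0 N l _ _ = refl
drop-ins-≤ (suc g') (suc g0) N (x ∷ l) (s≤s a) (s≤s b) = drop-ins-≤ g' g0 N l a b

drop-ins-> : ∀ g' g0 N l → g0 < g' → drop g' (ins g0 N l) ≡ drop (g' ∸ 1) l
drop-ins-> (suc g') zero N l _ = refl
drop-ins-> (suc (suc g')) (suc g0) N (x ∷ l) (s≤s b) = drop-ins-> (suc g') g0 N l b
drop-ins-> (suc (suc g')) (suc g0) N [] (s≤s b) = refl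

Sub-drop : ∀ {s} g l → Sub s (drop g l) → Sub s l
Sub-drop zero l sb = sb
Sub-drop (suc g) [] sb = sb
Sub-drop (suc g) (x ∷ l) sb = skip (Sub-drop g l sb)

Sub-++r : ∀ {xs P} S → Sub xs P → Sub xs (P ++ S)
Sub-++r S sub[] = []-Sub S
Sub-++r S (skip sb) = skip (Sub-++r S sb)
Sub-++r S (keep sb) = keep (Sub-++r S sb)

Sub-++l : ∀ {xs S} P → Sub xs S → Sub xs (P ++ S)
Sub-++l [] sb = sb
Sub-++l (x ∷ P) sb = skip (Sub-++l P sb)

Sub-take⇒Sub : ∀ {s} g l → Sub s (take g l) → Sub s l
Sub-take⇒Sub g l sb = subst (Sub _) (take++drop≡id g l) (Sub-++r (drop g l) sb)

All-Sub-singleton : ∀ {P : ℕ → Set} {x l} → All P l → Sub (x ∷ []) l → P x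
All-Sub-singleton a sb with Sub-all a sb
... | p ∷ [] = p

length-Sub : ∀ {s l} → Sub s l → length s ≤ length l
length-Sub sub[] = z≤n
length-Sub (skip sb) = m≤n⇒m≤1+n (length-Sub sb)
length-Sub (keep sb) = s≤s (length-Sub sb)

length-take≤ : ∀ g (l : List ℕ) → length (take g l) ≤ g
length-take≤ g l = ≤-trans (≤-reflexive (length-take g l)) (m⊓n≤m g (length l))

length-≤⇒≢++∷ : ∀ {s : List ℕ} xs {y ys} → length s ≤ length xs → s ≢ xs ++ y ∷ ys
length-≤⇒≢++∷ xs {y} {ys} p refl = <⇒≱ (subst (length xs <_) (sym (length-++ xs)) (m<m+n (length xs) z<s)) p

Σ< : ℕ → (ℕ → ℕ) → ℕ
Σ< zero f = 0
Σ< (suc n) f = f 0 + Σ< n (λ i → f (suc i))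

-- Unlike _≤ᵇ_, this comparison reduces when both arguments are successors.
_≤ᵇ′_ : ℕ → ℕ → Bool
zero ≤ᵇ′ n = true
suc m ≤ᵇ′ zero = false
suc m ≤ᵇ′ suc n = m ≤ᵇ′ n

≤⇒≤ᵇ′ : ∀ {m n} → m ≤ n → (m ≤ᵇ′ n) ≡ true
≤⇒≤ᵇ′ {zero} _ = refl
≤⇒≤ᵇ′ {suc m} {suc n} (s≤s p) = ≤⇒≤ᵇ′ p

>⇒≤ᵇ′-false : ∀ {m n} → n < m → (m ≤ᵇ′ n) ≡ false
>⇒≤ᵇ′-false {suc m} {zero} _ = refl
>⇒≤ᵇ′-false {suc m} {suc n} (s≤s p) = >⇒≤ᵇ′-false p

Σ-cong : ∀ n (f g : ℕ → ℕ) → (∀ i → i < n → f i ≡ g i) → Σ< n f ≡ Σ< n g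
Σ-cong zero f g h = refl
Σ-cong (suc n) f g h = cong₂ _+_ (h 0 (s≤s z≤n)) (Σ-cong n (λ i → f (suc i)) (λ i → g (suc i)) (λ i p → h (suc i) (s≤s p)))

Σ-zero : ∀ n (f : ℕ → ℕ) → (∀ i → i < n → f i ≡ 0) → Σ< n f ≡ 0
Σ-zero zero f h = refl
Σ-zero (suc n) f h rewrite h 0 (s≤s z≤n) = Σ-zero n (λ i → f (suc i)) (λ i p → h (suc i) (s≤s p))

Σ-+ : ∀ n (f g : ℕ → ℕ) → Σ< n (λ i → f i + g i) ≡ Σ< n f + Σ< n g
Σ-+ zero f g = refl
Σ-+ (suc n) f g rewrite Σ-+ n (λ i → f (suc i)) (λ i → g (suc i)) = +-interchange (f 0) (g 0) (Σ< n (λ i → f (suc i))) (Σ< n (λ i → g (suc i)))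

Σ-split : ∀ a b (f : ℕ → ℕ) → Σ< (a + b) f ≡ Σ< a f + Σ< b (λ i → f (a + i))
Σ-split zero b f = refl
Σ-split (suc a) b f rewrite Σ-split a b (λ i → f (suc i)) = sym (+-assoc (f 0) _ _)

Σ-last : ∀ n (f : ℕ → ℕ) → Σ< (suc n) f ≡ Σ< n f + f n
Σ-last n f = begin
  Σ< (suc n) f ≡⟨ cong (λ m → Σ< m f) (+-comm 1 n) ⟩
  Σ< (n + 1) f ≡⟨ Σ-split n 1 f ⟩
  Σ< n f + (f (n + 0) + 0) ≡⟨ cong (λ t → Σ< n f + t) (trans (+-identityʳ _) (cong f (+-identityʳ n))) ⟩
  Σ< n f + f n ∎

Σ-trunc : ∀ n x (h : ℕ → ℕ) → Σ< n (λ i → if i ≤ᵇ′ x then h i else 0) ≡ Σ< (suc x ⊓ n) h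
Σ-trunc zero x h = refl
Σ-trunc (suc n) zero h = cong (h 0 +_) (Σ-zero n _ (λ i _ → refl))
Σ-trunc (suc n) (suc x) h = cong (h 0 +_) (Σ-trunc n x (λ i → h (suc i)))

Σ-exchange : ∀ U K (f : ℕ → ℕ → ℕ) →
  Σ< (suc U) (λ g → Σ< (K ∸ g) (λ i → f g (g + i))) ≡ Σ< K (λ x → Σ< (suc (x ⊓ U)) (λ g → f g x))
Σ-exchange U zero f = Σ-zero (suc U) _ (λ i _ → refl)
Σ-exchange U (suc K) f = begin
  Σ< (suc U) (λ g → Σ< (suc K ∸ g) (λ i → f g (g + i)))
    ≡⟨ Σ-cong (suc U) _ _ step ⟩
  Σ< (suc U) (λ g → Σ< (K ∸ g) (λ i → f g (g + i)) + (if g ≤ᵇ′ K then f g K else 0))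
    ≡⟨ Σ-+ (suc U) (λ g → Σ< (K ∸ g) (λ i → f g (g + i))) (λ g → if g ≤ᵇ′ K then f g K else 0) ⟩
  Σ< (suc U) (λ g → Σ< (K ∸ g) (λ i → f g (g + i))) + Σ< (suc U) (λ g → if g ≤ᵇ′ K then f g K else 0)
    ≡⟨ cong₂ _+_ (Σ-exchange U K f) (Σ-trunc (suc U) K (λ g → f g K)) ⟩
  Σ< K (λ x → Σ< (suc (x ⊓ U)) (λ g → f g x)) + Σ< (suc K ⊓ suc U) (λ g → f g K)
    ≡⟨ sym (Σ-last K (λ x → Σ< (suc (x ⊓ U)) (λ g → f g x))) ⟩
  Σ< (suc K) (λ x → Σ< (suc (x ⊓ U)) (λ g → f g x)) ∎
  where
  step : ∀ g → g < suc U → Σ< (suc K ∸ g) (λ i → f g (g + i)) ≡ Σ< (K ∸ g) (λ i → f g (g + i)) + (if g ≤ᵇ′ K then f g K else 0)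
  step g _ with ≤-<-connex g K
  ... | inj₁ g≤K rewrite ≤⇒≤ᵇ′ g≤K | +-∸-assoc 1 g≤K =
        trans (Σ-last (K ∸ g) (λ i → f g (g + i))) (cong (λ t → Σ< (K ∸ g) (λ i → f g (g + i)) + f g t) (m+[n∸m]≡n g≤K))
  ... | inj₂ K<g rewrite >⇒≤ᵇ′-false K<g | m≤n⇒m∸n≡0 K<g | m≤n⇒m∸n≡0 (<⇒≤ K<g) = refl

sumBy : ∀ {A : Set} → List A → (A → ℕ) → ℕ
sumBy [] h = 0
sumBy (x ∷ xs) h = h x + sumBy xs h

sumBy-map : ∀ {A B : Set} (xs : List A) (f : A → B) h → sumBy (map f xs) h ≡ sumBy xs (λ x → h (f x))
sumBy-map [] f h = refl
sumBy-map (x ∷ xs) f h = cong (h (f x) +_) (sumBy-map xs f h)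

sumBy-filter : ∀ {A : Set} (p : A → Bool) xs h → sumBy (filterᵇ p xs) h ≡ sumBy xs (λ x → if p x then h x else 0)
sumBy-filter p [] h = refl
sumBy-filter p (x ∷ xs) h with p x
... | true = cong (h x +_) (sumBy-filter p xs h)
... | false = sumBy-filter p xs h

sumBy-insertions : ∀ N l (h : List ℕ → ℕ) → sumBy (insertions N l) h ≡ Σ< (suc (length l)) (λ g → h (ins g N l))
sumBy-insertions N [] h = refl
sumBy-insertions N (y ∷ ys) h = cong (h (N ∷ y ∷ ys) +_) (trans (sumBy-map (insertions N ys) (y ∷_) h) (sumBy-insertions N ys (λ t → h (y ∷ t))))

coeff-++ : ∀ st (xs ys : List (List ℕ)) k → coeff st (xs ++ ys) k ≡ coeff st xs k + coeff st ys k
coeff-++ st [] ys k = refl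
coeff-++ st (x ∷ xs) ys k with st x ≡ᵇ k
... | true = cong suc (coeff-++ st xs ys k)
... | false = coeff-++ st xs ys k

coeff-concatMap : ∀ st (f : List ℕ → List (List ℕ)) xs k → coeff st (concatMap f xs) k ≡ sumBy xs (λ x → coeff st (f x) k)
coeff-concatMap st f [] k = refl
coeff-concatMap st f (x ∷ xs) k = trans (coeff-++ st (f x) (concatMap f xs) k) (cong (coeff st (f x) k +_) (coeff-concatMap st f xs k))

children : (List ℕ → Bool) → List ℕ → List (List ℕ)
children av π = filterᵇ av (insertions (suc (length π)) π)

descendants : (List ℕ → Bool) → ℕ → List ℕ → List (List ℕ)
descendants av zero π = π ∷ []
descendants av (suc d) π = concatMap (descendants av d) (children av π)

descCoeff : (List ℕ → ℕ) → (List ℕ → Bool) → ℕ → List ℕ → ℕ → ℕ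
descCoeff st av d π k = coeff st (descendants av d π) k

descCoeff-suc : ∀ st av d π k → descCoeff st av (suc d) π k ≡ Σ< (suc (length π)) (λ g → if av (ins g (suc (length π)) π) then descCoeff st av d (ins g (suc (length π)) π) k else 0)
descCoeff-suc st av d π k = trans (coeff-concatMap st (descendants av d) (children av π) k)
  (trans (sumBy-filter av (insertions (suc (length π)) π) (λ c → descCoeff st av d c k))
         (sumBy-insertions (suc (length π)) π (λ c → if av c then descCoeff st av d c k else 0)))

All-concatMap : ∀ {P Q : List ℕ → Set} (f : List ℕ → List (List ℕ)) xs → (∀ x → P x → All Q (f x)) → All P xs → All Q (concatMap f xs)
All-concatMap f [] h [] = []
All-concatMap f (x ∷ xs) h (px ∷ pxs) = ++⁺ (h x px) (All-concatMap f xs h pxs)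

All-insertions : ∀ {P : List ℕ → Set} N l → (∀ g → P (ins g N l)) → All P (insertions N l)
All-insertions N [] h = h 0 ∷ []
All-insertions {P} N (y ∷ ys) h = h 0 ∷ All-map⁺ (All-insertions {λ t → P (y ∷ t)} N ys (λ g → h (suc g)))

All-length-perms : ∀ n → All (λ π → length π ≡ n) (perms n)
All-length-perms zero = refl ∷ []
All-length-perms (suc n) = All-concatMap (insertions (suc n)) (perms n)
  (λ π eq → All-insertions (suc n) π (λ g → trans (length-ins g (suc n) π) (cong suc eq))) (All-length-perms n)

any-mono : ∀ (pats : List (List ℕ)) (f g : List ℕ → Bool) → (∀ σ → f σ ≡ true → g σ ≡ true) → any f pats ≡ true → any g pats ≡ true
any-mono (σ ∷ pats) f g h e with f σ in eq
... | true rewrite h σ eq = refl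
... | false = ∨-trueʳ (g σ) _ (any-mono pats f g h e)

not-true⁻ : ∀ b → not b ≡ true → b ≡ false
not-true⁻ false _ = refl

avoidsAll-ins⁻ : ∀ pats π g N → avoidsAll pats (ins g N π) ≡ true → avoidsAll pats π ≡ true
avoidsAll-ins⁻ pats π g N e with any (contains π) pats in eq
... | false = refl
... | true with trans (sym (any-mono pats (contains π) (contains (ins g N π)) (λ σ → contains-ins π σ g N) eq)) (not-true⁻ _ e)
... | ()

filter-insertions-contained : ∀ pats π N → avoidsAll pats π ≡ false → filterᵇ (avoidsAll pats) (insertions N π) ≡ []
filter-insertions-contained pats π N e = go (insertions N π) (All-insertions {λ c → Σ ℕ λ g → c ≡ ins g N π} N π (λ g → g , refl))
  where
  go : ∀ cs → All (λ c → Σ ℕ λ g → c ≡ ins g N π) cs → filterᵇ (avoidsAll pats) cs ≡ []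
  go [] [] = refl
  go (c ∷ cs) ((g , refl) ∷ a) with avoidsAll pats (ins g N π) in eq
  ... | false = go cs a
  ... | true with trans (sym (avoidsAll-ins⁻ pats π g N eq)) e
  ... | ()

filter-concatMap : ∀ (p : List ℕ → Bool) (f : List ℕ → List (List ℕ)) xs → filterᵇ p (concatMap f xs) ≡ concatMap (λ x → filterᵇ p (f x)) xs
filter-concatMap p f [] = refl
filter-concatMap p f (x ∷ xs) = trans (filter-++ _ (f x) (concatMap f xs)) (cong (filterᵇ p (f x) ++_) (filter-concatMap p f xs))

Av-suc : ∀ pats n → Av (suc n) pats ≡ concatMap (children (avoidsAll pats)) (Av n pats)
Av-suc pats n = trans (filter-concatMap (avoidsAll pats) (insertions (suc n)) (perms n)) (go (perms n) (All-length-perms n))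
  where
  go : ∀ ps → All (λ π → length π ≡ n) ps → concatMap (λ x → filterᵇ (avoidsAll pats) (insertions (suc n) x)) ps ≡ concatMap (children (avoidsAll pats)) (filterᵇ (avoidsAll pats) ps)
  go [] [] = refl
  go (π ∷ ps) (refl ∷ a) with avoidsAll pats π in eq
  ... | true = cong (children (avoidsAll pats) π ++_) (go ps a)
  ... | false = trans (cong (λ t → t ++ concatMap (λ x → filterᵇ (avoidsAll pats) (insertions (suc (length π)) x)) ps) (filter-insertions-contained pats π (suc (length π)) eq)) (go ps a)

concatMap-assoc : ∀ (f g : List ℕ → List (List ℕ)) xs → concatMap g (concatMap f xs) ≡ concatMap (λ x → concatMap g (f x)) xs
concatMap-assoc f g [] = refl
concatMap-assoc f g (x ∷ xs) = trans (concatMap-++ g (f x) (concatMap f xs)) (cong (concatMap g (f x) ++_) (concatMap-assoc f g xs))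

descendants-suc : ∀ av d π → concatMap (children av) (descendants av d π) ≡ descendants av (suc d) π
descendants-suc av zero π = trans (++-identityʳ (children av π)) (sym (concatMap-pure (children av π)))
descendants-suc av (suc d) π = trans (concatMap-assoc (descendants av d) (children av) (children av π))
  (concatMap-cong (descendants-suc av d) (children av π))

Av≡descendants : ∀ pats d → avoidsAll pats (1 ∷ []) ≡ true → Av (suc d) pats ≡ descendants (avoidsAll pats) d (1 ∷ [])
Av≡descendants pats zero e rewrite e = refl
Av≡descendants pats (suc d) e = trans (Av-suc pats (suc d)) (trans (cong (concatMap (children (avoidsAll pats))) (Av≡descendants pats d e)) (descendants-suc (avoidsAll pats) d (1 ∷ [])))

coeff-∷ : ∀ (st : List ℕ → ℕ) π L k → coeff st (π ∷ L) k ≡ (if st π ≡ᵇ k then 1 else 0) + coeff st L k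
coeff-∷ st π L k with st π ≡ᵇ k
... | true = refl
... | false = refl

-- The coefficient sequence of p^r · P(p).
shift : ℕ → (ℕ → ℕ) → ℕ → ℕ
shift zero P k = P k
shift (suc r) P zero = 0
shift (suc r) P (suc k) = shift r P k

shift-cong : ∀ r (P R : ℕ → ℕ) → (∀ k → P k ≡ R k) → ∀ k → shift r P k ≡ shift r R k
shift-cong zero P R h k = h k
shift-cong (suc r) P R h zero = refl
shift-cong (suc r) P R h (suc k) = shift-cong r P R h k

shift-+ : ∀ r (P R : ℕ → ℕ) k → shift r (λ k → P k + R k) k ≡ shift r P k + shift r R k
shift-+ zero P R k = refl
shift-+ (suc r) P R zero = refl
shift-+ (suc r) P R (suc k) = shift-+ r P R k

shift-zero : ∀ r (P : ℕ → ℕ) k → (∀ k → P k ≡ 0) → shift r P k ≡ 0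
shift-zero zero P k h = h k
shift-zero (suc r) P zero h = refl
shift-zero (suc r) P (suc k) h = shift-zero r P k h

shift-Σ : ∀ r n (P : ℕ → ℕ → ℕ) k → shift r (λ k → Σ< n (λ i → P i k)) k ≡ Σ< n (λ i → shift r (P i) k)
shift-Σ r zero P k = shift-zero r (λ _ → 0) k (λ _ → refl)
shift-Σ r (suc n) P k = trans (shift-+ r (P 0) (λ k → Σ< n (λ i → P (suc i) k)) k) (cong (shift r (P 0) k +_) (shift-Σ r n (λ i → P (suc i)) k))

shift-suc : ∀ r (P : ℕ → ℕ) k → shift (suc r) P k ≡ shift r (shift 1 P) k
shift-suc zero P k = refl
shift-suc (suc r) P zero = refl
shift-suc (suc r) P (suc k) = shift-suc r P k

-- Q d m counts, by number of right-to-left maxima, what a gap with label m = g ⊓ U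
-- contributes to the descendants at depth d, before shifting by the number of
-- right-to-left maxima to the right of that gap.
Q Qprefix Qgap : ℕ → ℕ → ℕ → ℕ

Q zero zero zero = 1
Q zero zero (suc k) = 0
Q zero (suc m) k = 0
Q (suc d) m k = shift 1 (Qprefix d m) k + Qgap d m k

Qprefix d m k = Σ< (suc m) (λ j → Q d j k)

Qgap d m k = Σ< m (λ j → Q d (suc (suc j)) k) + Q d (suc m) k

shift-Q₀ : ∀ r k → shift r (Q 0 0) k ≡ (if r ≡ᵇ k then 1 else 0)
shift-Q₀ zero zero = refl
shift-Q₀ zero (suc k) = refl
shift-Q₀ (suc r) zero = refl
shift-Q₀ (suc r) (suc k) = shift-Q₀ r k

treeCount : ℕ → ℕ → ℕ → (ℕ → ℕ) → ℕ → ℕ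
treeCount d K u ρ k = Σ< K (λ g → shift (ρ g) (Q d (g ⊓ u)) k)

treeCount-cong : ∀ d K U ρ ρ' k → (∀ g → ρ g ≡ ρ' g) → treeCount d K U ρ k ≡ treeCount d K U ρ' k
treeCount-cong d K U ρ ρ' k h = Σ-cong K _ _ (λ g _ → cong (λ r → shift r (Q d (g ⊓ U)) k) (h g))

childProfile : (ℕ → ℕ) → ℕ → ℕ → ℕ
childProfile ρ g₀ g = if g ≤ᵇ′ g₀ then suc (ρ g₀) else ρ (g ∸ 1)

childProfile-≤ : ∀ ρ {g₀ g} → g ≤ g₀ → childProfile ρ g₀ g ≡ suc (ρ g₀)
childProfile-≤ ρ g≤g₀ rewrite ≤⇒≤ᵇ′ g≤g₀ = refl

childProfile-> : ∀ ρ g₀ i → childProfile ρ g₀ (suc g₀ + i) ≡ ρ (g₀ + i)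
childProfile-> ρ g₀ i rewrite >⇒≤ᵇ′-false {suc g₀ + i} {g₀} (s≤s (m≤m+n g₀ i)) = refl

treeCount-prefix : ∀ d r m u ρ k → m ≤ u → (∀ g → g ≤ m → ρ g ≡ suc r) →
  treeCount d (suc m) u ρ k ≡ shift r (shift 1 (Qprefix d m)) k
treeCount-prefix d r m u ρ k m≤u ρ≡ = begin
  Σ< (suc m) (λ g → shift (ρ g) (Q d (g ⊓ u)) k)
    ≡⟨ Σ-cong (suc m) _ _ (λ g g≤m → cong₂ (λ r m → shift r (Q d m) k) (ρ≡ g (≤-pred g≤m)) (m≤n⇒m⊓n≡m (≤-trans (≤-pred g≤m) m≤u))) ⟩
  Σ< (suc m) (λ g → shift (suc r) (Q d g) k)
    ≡⟨ sym (shift-Σ (suc r) (suc m) (Q d) k) ⟩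
  shift (suc r) (Qprefix d m) k
    ≡⟨ shift-suc r (Qprefix d m) k ⟩
  shift r (shift 1 (Qprefix d m)) k ∎

treeCount-big-child : ∀ d ρ K g0 u' k → g0 < K → g0 ≤ u' →
  treeCount d (suc K) u' (childProfile ρ g0) k ≡ shift (ρ g0) (shift 1 (Qprefix d g0)) k + Σ< (K ∸ g0) (λ i → shift (ρ (g0 + i)) (Q d (suc (g0 + i) ⊓ u')) k)
treeCount-big-child d ρ K g0 u' k g0<K g0≤u' = begin
  Σ< (suc K) (λ g' → shift (childProfile ρ g0 g') (Q d (g' ⊓ u')) k)
    ≡⟨ cong (λ m → Σ< m (λ g' → shift (childProfile ρ g0 g') (Q d (g' ⊓ u')) k)) eqK ⟩
  Σ< (suc g0 + (K ∸ g0)) (λ g' → shift (childProfile ρ g0 g') (Q d (g' ⊓ u')) k)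
    ≡⟨ Σ-split (suc g0) (K ∸ g0) (λ g' → shift (childProfile ρ g0 g') (Q d (g' ⊓ u')) k) ⟩
  Σ< (suc g0) (λ g' → shift (childProfile ρ g0 g') (Q d (g' ⊓ u')) k) + Σ< (K ∸ g0) (λ i → shift (childProfile ρ g0 (suc g0 + i)) (Q d ((suc g0 + i) ⊓ u')) k)
    ≡⟨ cong₂ _+_ (treeCount-prefix d (ρ g0) g0 u' (childProfile ρ g0) k g0≤u' (λ g → childProfile-≤ ρ)) (Σ-cong (K ∸ g0) _ _ (λ i _ → cong (λ r → shift r (Q d (suc (g0 + i) ⊓ u')) k) (childProfile-> ρ g0 i))) ⟩
  shift (ρ g0) (shift 1 (Qprefix d g0)) k + Σ< (K ∸ g0) (λ i → shift (ρ (g0 + i)) (Q d (suc (g0 + i) ⊓ u')) k) ∎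
  where
  eqK : suc K ≡ suc g0 + (K ∸ g0)
  eqK = cong suc (sym (m+[n∸m]≡n (<⇒≤ g0<K)))

Σ-left-parts : ∀ d K u (ρ : ℕ → ℕ) k → u < K →
  Σ< (suc u) (λ g → shift (ρ g) (shift 1 (Qprefix d g)) k) + Σ< (K ∸ suc u) (λ i → shift (ρ (suc u + i)) (shift 1 (Qprefix d u)) k)
    ≡ Σ< K (λ x → shift (ρ x) (shift 1 (Qprefix d (x ⊓ u))) k)
Σ-left-parts d K u ρ k u<K = sym (begin
  Σ< K L
    ≡⟨ cong (λ m → Σ< m L) (sym (m+[n∸m]≡n u<K)) ⟩
  Σ< (suc u + (K ∸ suc u)) L
    ≡⟨ Σ-split (suc u) (K ∸ suc u) L ⟩
  Σ< (suc u) L + Σ< (K ∸ suc u) (λ i → L (suc u + i))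
    ≡⟨ cong₂ _+_ (Σ-cong (suc u) _ _ (λ x p → cong (λ m → shift (ρ x) (shift 1 (Qprefix d m)) k) (m≤n⇒m⊓n≡m (≤-pred p))))
                 (Σ-cong (K ∸ suc u) _ _ (λ i _ → cong (λ m → shift (ρ (suc u + i)) (shift 1 (Qprefix d m)) k) (m≥n⇒m⊓n≡n (≤-trans (n≤1+n u) (m≤m+n (suc u) i))))) ⟩
  Σ< (suc u) (λ g → shift (ρ g) (shift 1 (Qprefix d g)) k) + Σ< (K ∸ suc u) (λ i → shift (ρ (suc u + i)) (shift 1 (Qprefix d u)) k) ∎)
  where
  L : ℕ → ℕ
  L x = shift (ρ x) (shift 1 (Qprefix d (x ⊓ u))) k

Σ-right-parts : ∀ d K u (ρ grow : ℕ → ℕ) k →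
  (∀ x → x < K → ∀ k → Σ< (suc (x ⊓ u)) (λ g → Q d (suc x ⊓ grow g) k) ≡ Qgap d (x ⊓ u) k) →
  Σ< (suc u) (λ g → Σ< (K ∸ g) (λ i → shift (ρ (g + i)) (Q d (suc (g + i) ⊓ grow g)) k))
    ≡ Σ< K (λ x → shift (ρ x) (Qgap d (x ⊓ u)) k)
Σ-right-parts d K u ρ grow k Σ-Q-grow = begin
  Σ< (suc u) (λ g → Σ< (K ∸ g) (λ i → shift (ρ (g + i)) (Q d (suc (g + i) ⊓ grow g)) k))
    ≡⟨ Σ-exchange u K (λ g x → shift (ρ x) (Q d (suc x ⊓ grow g)) k) ⟩
  Σ< K (λ x → Σ< (suc (x ⊓ u)) (λ g → shift (ρ x) (Q d (suc x ⊓ grow g)) k))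
    ≡⟨ Σ-cong K _ _ (λ x p → trans (sym (shift-Σ (ρ x) (suc (x ⊓ u)) (λ g → Q d (suc x ⊓ grow g)) k))
                                   (shift-cong (ρ x) _ (Qgap d (x ⊓ u)) (Σ-Q-grow x p) k)) ⟩
  Σ< K (λ x → shift (ρ x) (Qgap d (x ⊓ u)) k) ∎

-- Inserting at an active gap g ≤ u: every gap of the child up to g sees the new
-- maximum, giving shift 1 (Qprefix d g); the later gaps keep their profile and, after
-- exchanging the two sums, give Qgap. Inserting at g > u: the child has only u + 1
-- active gaps, all before the new maximum.
treeCount-suc : ∀ d K u ρ (grow : ℕ → ℕ) k → u < K →
  (∀ g → g ≤ u → g ≤ grow g) →
  (∀ x → x < K → ∀ k → Σ< (suc (x ⊓ u)) (λ g → Q d (suc x ⊓ grow g) k) ≡ Qgap d (x ⊓ u) k) →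
  Σ< (suc u) (λ g → treeCount d (suc K) (grow g) (childProfile ρ g) k) + Σ< (K ∸ suc u) (λ i → treeCount d (suc u) u (childProfile ρ (suc u + i)) k)
    ≡ treeCount (suc d) K u ρ k
treeCount-suc d K u ρ grow k u<K grow-≥ Σ-Q-grow = begin
  Σ< (suc u) (λ g → treeCount d (suc K) (grow g) (childProfile ρ g) k) + Σ< (K ∸ suc u) (λ i → treeCount d (suc u) u (childProfile ρ (suc u + i)) k)
    ≡⟨ cong₂ _+_ (Σ-cong (suc u) _ (λ g → A g + B g) (λ g p → treeCount-big-child d ρ K g (grow g) k (≤-<-trans (≤-pred p) u<K) (grow-≥ g (≤-pred p))))
                 (Σ-cong (K ∸ suc u) _ C (λ i _ → treeCount-prefix d (ρ (suc u + i)) u u (childProfile ρ (suc u + i)) k ≤-refl (λ g g≤u → childProfile-≤ ρ (≤-trans g≤u (≤-trans (n≤1+n u) (m≤m+n (suc u) i)))))) ⟩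
  Σ< (suc u) (λ g → A g + B g) + Σ< (K ∸ suc u) C
    ≡⟨ cong (_+ Σ< (K ∸ suc u) C) (Σ-+ (suc u) A B) ⟩
  (Σ< (suc u) A + Σ< (suc u) B) + Σ< (K ∸ suc u) C
    ≡⟨ +-assoc (Σ< (suc u) A) _ _ ⟩
  Σ< (suc u) A + (Σ< (suc u) B + Σ< (K ∸ suc u) C)
    ≡⟨ cong (Σ< (suc u) A +_) (+-comm (Σ< (suc u) B) _) ⟩
  Σ< (suc u) A + (Σ< (K ∸ suc u) C + Σ< (suc u) B)
    ≡⟨ sym (+-assoc (Σ< (suc u) A) _ _) ⟩
  (Σ< (suc u) A + Σ< (K ∸ suc u) C) + Σ< (suc u) B
    ≡⟨ cong₂ _+_ (Σ-left-parts d K u ρ k u<K) (Σ-right-parts d K u ρ grow k Σ-Q-grow) ⟩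
  Σ< K (λ x → shift (ρ x) (shift 1 (Qprefix d (x ⊓ u))) k) + Σ< K (λ x → shift (ρ x) (Qgap d (x ⊓ u)) k)
    ≡⟨ sym (Σ-+ K (λ x → shift (ρ x) (shift 1 (Qprefix d (x ⊓ u))) k) (λ x → shift (ρ x) (Qgap d (x ⊓ u)) k)) ⟩
  Σ< K (λ x → shift (ρ x) (shift 1 (Qprefix d (x ⊓ u))) k + shift (ρ x) (Qgap d (x ⊓ u)) k)
    ≡⟨ Σ-cong K _ _ (λ x _ → sym (shift-+ (ρ x) (shift 1 (Qprefix d (x ⊓ u))) (Qgap d (x ⊓ u)) k)) ⟩
  treeCount (suc d) K u ρ k ∎
  where
  A B C : ℕ → ℕ
  A g = shift (ρ g) (shift 1 (Qprefix d g)) k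
  B g = Σ< (K ∸ g) (λ i → shift (ρ (g + i)) (Q d (suc (g + i) ⊓ grow g)) k)
  C i = shift (ρ (suc u + i)) (shift 1 (Qprefix d u)) k

growB : ℕ → ℕ → ℕ
growB u g0 = suc u ⊓ (2 + g0)

growA : ℕ → ℕ → ℕ
growA u g0 = if g0 ≤ᵇ′ 1 then suc u else g0

growB-≥ : ∀ u g0 → g0 ≤ u → g0 ≤ growB u g0
growB-≥ u g0 p = ⊓-glb (≤-trans p (n≤1+n u)) (≤-trans (n≤1+n g0) (n≤1+n (suc g0)))

growA-≥ : ∀ u g0 → g0 ≤ u → g0 ≤ growA u g0
growA-≥ u g0 p with g0 ≤ᵇ′ 1
... | true = ≤-trans p (n≤1+n u)
... | false = ≤-refl

Σ-Q-growB : ∀ d x u k → Σ< (suc (x ⊓ u)) (λ g0 → Q d (suc x ⊓ growB u g0) k) ≡ Qgap d (x ⊓ u) k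
Σ-Q-growB d x u k = begin
  Σ< (suc m) (λ g0 → Q d (suc x ⊓ growB u g0) k)
    ≡⟨ Σ-cong (suc m) _ (λ g0 → Q d (suc m ⊓ (2 + g0)) k) (λ g0 _ → cong (λ t → Q d t k) (sym (⊓-assoc (suc x) (suc u) (2 + g0)))) ⟩
  Σ< (suc m) (λ g0 → Q d (suc m ⊓ (2 + g0)) k)
    ≡⟨ Σ-last m (λ g0 → Q d (suc m ⊓ (2 + g0)) k) ⟩
  Σ< m (λ g0 → Q d (suc m ⊓ (2 + g0)) k) + Q d (suc m ⊓ (2 + m)) k
    ≡⟨ cong₂ _+_ (Σ-cong m _ _ (λ g0 p → cong (λ t → Q d t k) (m≥n⇒m⊓n≡n (s≤s p))))
                 (cong (λ t → Q d t k) (m≤n⇒m⊓n≡m (n≤1+n (suc m)))) ⟩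
  Qgap d m k ∎
  where
  m = x ⊓ u

Σ-Q-growA : ∀ d x u k → Σ< (suc (x ⊓ u)) (λ g0 → Q d (suc x ⊓ growA u g0) k) ≡ Qgap d (x ⊓ u) k
Σ-Q-growA d x u k = go m refl
  where
  m = x ⊓ u
  m≤x : m ≤ x
  m≤x = m⊓n≤m x u
  go : ∀ m' → m' ≡ m → Σ< (suc m') (λ g0 → Q d (suc x ⊓ growA u g0) k) ≡ Qgap d m' k
  go zero e = trans (+-identityʳ _) (cong (λ t → Q d (suc t) k) (sym e))
  go (suc m') e = begin
    Q d (suc x ⊓ suc u) k + (Q d (suc x ⊓ suc u) k + Σ< m' (λ j → Q d (suc x ⊓ growA u (suc (suc j))) k))
      ≡⟨ cong₂ (λ a b → Q d a k + (Q d a k + b)) (cong suc (sym e)) (Σ-cong m' _ _ (λ j p → cong (λ t → Q d t k) (m≥n⇒m⊓n≡n (≤-trans (s≤s p) (≤-trans (≤-reflexive e) (≤-trans m≤x (n≤1+n x))))))) ⟩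
    Q d (suc (suc m')) k + (Q d (suc (suc m')) k + Σ< m' (λ j → Q d (suc (suc j)) k))
      ≡⟨ rearr2 (Q d (suc (suc m')) k) (Σ< m' (λ j → Q d (suc (suc j)) k)) ⟩
    (Σ< m' (λ j → Q d (suc (suc j)) k) + Q d (suc (suc m')) k) + Q d (suc (suc m')) k
      ≡⟨ cong (_+ Q d (suc (suc m')) k) (sym (Σ-last m' (λ j → Q d (suc (suc j)) k))) ⟩
    Qgap d (suc m') k ∎
    where
    rearr2 : ∀ a b → a + (a + b) ≡ (b + a) + a
    rearr2 a b = trans (+-comm a (a + b)) (cong (_+ a) (+-comm a b))

module Insertion (τ : ℕ → ℕ → ℕ → Set) (key : ℕ → ℕ → ℕ → ℕ)
  (key-≥ : ∀ {a b c} → τ a b c → a ≤ key a b c × b ≤ key a b c × c ≤ key a b c)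
  (key-< : ∀ {a b c N} → τ a b c → a < N → b < N → c < N → key a b c < N) where

  Forbidden : List ℕ → Set
  Forbidden = Occ5 (Sem τ key)

  data Occ3 (l : List ℕ) : Set where
    occ3 : ∀ a b c → Sub (a ∷ b ∷ c ∷ []) l → τ a b c → Occ3 l

  -- In a forbidden occurrence created by inserting a new maximum, the maximum can only
  -- play d or e; the rest of the occurrence is an obstruction at the insertion gap.
  data Obstruction (l : List ℕ) (g : ℕ) : Set where
    obstruction : ∀ P S a b c w → l ≡ P ++ S → length P ≤ g → Sub (a ∷ b ∷ c ∷ []) P → τ a b c → Sub (w ∷ []) S → key a b c < w → Obstruction l g

  key<max : ∀ {N a b c} → All (_< N) (a ∷ b ∷ c ∷ []) → τ a b c → key a b c < N
  key<max (pa ∷ pb ∷ pc ∷ []) t = key-< t pa pb pc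

  max∉occ3 : ∀ {N a b c w} → (N ≡ a ⊎ N ≡ b ⊎ N ≡ c) → τ a b c → key a b c < w → w < N → ⊥
  max∉occ3 (inj₁ refl) t kw wN = <-irrefl refl (≤-<-trans (proj₁ (key-≥ t)) (<-trans kw wN))
  max∉occ3 (inj₂ (inj₁ refl)) t kw wN = <-irrefl refl (≤-<-trans (proj₁ (proj₂ (key-≥ t))) (<-trans kw wN))
  max∉occ3 (inj₂ (inj₂ refl)) t kw wN = <-irrefl refl (≤-<-trans (proj₂ (proj₂ (key-≥ t))) (<-trans kw wN))

  Forbidden-ins⇒Obstruction : ∀ {N} g l → All (_< N) l → ¬ Forbidden l → Forbidden (ins g N l) → Obstruction l g
  Forbidden-ins⇒Obstruction {N} g l al nf (occ5 a b c d e sb (t , kd , ke , de)) rewrite ins≡take++drop g N l with Sub-mid (take g l) sb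
  ... | inj₁ sb' = ⊥-elim (nf (occ5 a b c d e (subst (Sub _) (take++drop≡id g l) sb') (t , kd , ke , de)))
  ... | inj₂ ([] , .(b ∷ c ∷ d ∷ e ∷ []) , refl , sb1 , sb2) = ⊥-elim (max∉occ3 (inj₁ refl) t kd (All-Sub-singleton (drop⁺ g al) (Sub-trans (skip (skip (keep ([]-Sub _)))) sb2)))
  ... | inj₂ (.a ∷ [] , .(c ∷ d ∷ e ∷ []) , refl , sb1 , sb2) = ⊥-elim (max∉occ3 (inj₂ (inj₁ refl)) t kd (All-Sub-singleton (drop⁺ g al) (Sub-trans (skip (keep ([]-Sub _))) sb2)))
  ... | inj₂ (.a ∷ .b ∷ [] , .(d ∷ e ∷ []) , refl , sb1 , sb2) = ⊥-elim (max∉occ3 (inj₂ (inj₂ refl)) t kd (All-Sub-singleton (drop⁺ g al) (Sub-trans (keep ([]-Sub _)) sb2)))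
  ... | inj₂ (.a ∷ .b ∷ .c ∷ [] , .(e ∷ []) , refl , sb1 , sb2) =
        obstruction (take g l) (drop g l) a b c e (sym (take++drop≡id g l)) (length-take≤ g l) sb1 t sb2 ke
  ... | inj₂ (.a ∷ .b ∷ .c ∷ .d ∷ [] , [] , refl , sb1 , sb2) with Sub-split (a ∷ b ∷ c ∷ []) {d ∷ []} sb1
  ... | P' , S' , e1 , s1 , s2 = obstruction P' (S' ++ drop g l) a b c d eqL lenP s1 t (Sub-++r (drop g l) s2) kd
    where
    eqL : l ≡ P' ++ (S' ++ drop g l)
    eqL = trans (sym (take++drop≡id g l)) (trans (cong (_++ drop g l) e1) (++-assoc P' S' (drop g l)))
    lenP : length P' ≤ g
    lenP = ≤-trans (≤-trans (m≤m+n (length P') (length S')) (≤-reflexive (sym (trans (cong length e1) (length-++ P'))))) (length-take≤ g l)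
  Forbidden-ins⇒Obstruction {N} g l al nf (occ5 a b c d e sb (t , kd , ke , de)) | inj₂ (x ∷ y ∷ z ∷ w ∷ v ∷ xs , s2 , eq , _ , _) = ⊥-elim (length-≤⇒≢++∷ (x ∷ y ∷ z ∷ w ∷ v ∷ xs) (s≤s (s≤s (s≤s (s≤s (s≤s z≤n))))) eq)

  Obstruction⇒Forbidden-ins : ∀ {N} g l → All (_< N) l → Obstruction l g → Forbidden (ins g N l)
  Obstruction⇒Forbidden-ins {N} g .(P ++ S) al (obstruction P S a b c w refl lenP sb t sw kw) rewrite ins-++r P S g N lenP
    with Sub-pair-ins N (g ∸ length P) S sw
  ... | inj₁ r = occ5 a b c w N (Sub-++ sb r) (t , kw , kN , <⇒≢ wN)
    where
    kN = key<max (Sub-all al (Sub-++r S sb)) t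
    wN = All-Sub-singleton al (Sub-++l P sw)
  ... | inj₂ r = occ5 a b c N w (Sub-++ sb r) (t , kN , kw , >⇒≢ wN)
    where
    kN = key<max (Sub-all al (Sub-++r S sb)) t
    wN = All-Sub-singleton al (Sub-++l P sw)

  Obstruction⇒Occ3-take : ∀ l g → Obstruction l g → Occ3 (take g l)
  Obstruction⇒Occ3-take .(P ++ S) g (obstruction P S a b c w refl lenP sb t sw kw) = occ3 a b c (Sub-take-++ P S g lenP sb) t

  Obstruction-ins-left⁻ : ∀ {N} g' g0 l → g0 ≤ length l → g' ≤ g0 → Obstruction (ins g0 N l) g' → Occ3 (take g' l)
  Obstruction-ins-left⁻ {N} g' g0 l gl p h = subst Occ3 (take-ins-≤ g' g0 N l gl p) (Obstruction⇒Occ3-take (ins g0 N l) g' h)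

  Obstruction-ins-left⁺ : ∀ {N} g' g0 l → All (_< N) l → g0 ≤ length l → g' ≤ g0 → Occ3 (take g' l) → Obstruction (ins g0 N l) g'
  Obstruction-ins-left⁺ {N} g' g0 l al gl p (occ3 a b c sb t) =
    obstruction (take g' (ins g0 N l)) (drop g' (ins g0 N l)) a b c N (sym (take++drop≡id g' (ins g0 N l))) (length-take≤ g' _)
       (subst (Sub _) (sym (take-ins-≤ g' g0 N l gl p)) sb) t
       (subst (Sub _) (sym (drop-ins-≤ g' g0 N l gl p)) (max-Sub-ins N (g0 ∸ g') (drop g' l)))
       (key<max (Sub-all al (Sub-take⇒Sub g' l sb)) t)

  Obstruction-ins-right⁻ : ∀ {N} g' g0 l → All (_< N) l → g0 ≤ length l → g0 < g' → Obstruction (ins g0 N l) g' → Occ3 (take g0 l) ⊎ Obstruction l (g' ∸ 1)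
  Obstruction-ins-right⁻ {N} g' g0 l al gl p (obstruction P S a b c w e lenP sb t sw kw) with ++≡ins⁻ P S g0 N l gl (sym e)
  ... | inj₁ (q , S₀ , e3 , e4) = inj₁ (occ3 a b c (subst (λ t → Sub _ (take g0 t)) (sym e3) (Sub-take-++ P S₀ g0 q sb)) t)
  ... | inj₂ (q , P₀ , e3 , e4) with Sub-mid (take g0 P₀) (subst (Sub _) (trans e4 (ins≡take++drop g0 N P₀)) sb)
  ...   | inj₁ sb' = inj₂ (obstruction P₀ S a b c w e3 lenP₀ (subst (Sub _) (take++drop≡id g0 P₀) sb') t sw kw)
    where
    lenP₀ : length P₀ ≤ g' ∸ 1
    lenP₀ = ≤-trans (≤-reflexive (sym (cong pred (trans (cong length e4) (length-ins g0 N P₀))))) (∸-monoˡ-≤ 1 lenP)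
  ...   | inj₂ (s1 , s2 , eq , _ , _) = ⊥-elim (max∉occ3 (max∈shape s1 s2 eq) t kw (All-Sub-singleton al (subst (Sub _) (sym e3) (Sub-++l P₀ sw))))
    where
    max∈shape : ∀ s1 s2 → a ∷ b ∷ c ∷ [] ≡ s1 ++ N ∷ s2 → N ≡ a ⊎ N ≡ b ⊎ N ≡ c
    max∈shape [] s2 refl = inj₁ refl
    max∈shape (_ ∷ []) s2 refl = inj₂ (inj₁ refl)
    max∈shape (_ ∷ _ ∷ []) s2 refl = inj₂ (inj₂ refl)
    max∈shape (x ∷ y ∷ z ∷ xs) s2 eq = ⊥-elim (length-≤⇒≢++∷ (x ∷ y ∷ z ∷ xs) (s≤s (s≤s (s≤s z≤n))) eq)

  Obstruction-ins-right⁺ˡ : ∀ {N} g' g0 l → All (_< N) l → g0 ≤ g' → Occ3 (take g0 l) → Obstruction (ins g0 N l) g'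
  Obstruction-ins-right⁺ˡ {N} g' g0 l al p (occ3 a b c sb t) =
    obstruction (take g0 l) (N ∷ drop g0 l) a b c N (ins≡take++drop g0 N l) (≤-trans (length-take≤ g0 l) p) sb t (keep ([]-Sub _))
       (key<max (Sub-all al (Sub-take⇒Sub g0 l sb)) t)

  Obstruction-ins-right⁺ʳ : ∀ {N} g' g0 l → g0 < g' → Obstruction l (g' ∸ 1) → Obstruction (ins g0 N l) g'
  Obstruction-ins-right⁺ʳ {N} g' g0 .(P ++ S) p (obstruction P S a b c w refl lenP sb t sw kw) with ≤-<-connex (length P) g0
  ... | inj₁ q = obstruction P (ins (g0 ∸ length P) N S) a b c w (ins-++r P S g0 N q) (≤-trans lenP (m∸n≤m g' 1)) sb t (Sub-ins (g0 ∸ length P) N sw) kw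
  ... | inj₂ q = obstruction (ins g0 N P) S a b c w (ins-++l P S g0 N (<⇒≤ q)) lenP' (Sub-ins g0 N sb) t sw kw
    where
    lenP' : length (ins g0 N P) ≤ g'
    lenP' = subst (_≤ g') (sym (length-ins g0 N P)) (subst (suc (length P) ≤_) (suc[g∸1]≡g g' p) (s≤s lenP))
      where
      suc[g∸1]≡g : ∀ g' → g0 < g' → suc (g' ∸ 1) ≡ g'
      suc[g∸1]≡g (suc g') _ = refl

Distinct : List ℕ → Set
Distinct l = ∀ b c → Sub (b ∷ c ∷ []) l → b ≢ c

Distinct-ins : ∀ {N} g l → Distinct l → All (_< N) l → Distinct (ins g N l)
Distinct-ins {N} g l dl al b c sb rewrite ins≡take++drop g N l with Sub-mid (take g l) sb
... | inj₁ sb' = dl b c (subst (Sub _) (take++drop≡id g l) sb')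
... | inj₂ ([] , .(c ∷ []) , refl , _ , s2) = λ e → <-irrefl (sym e) (All-Sub-singleton (drop⁺ g al) s2)
... | inj₂ (.b ∷ [] , .[] , refl , s1 , _) = λ e → <-irrefl e (All-Sub-singleton (take⁺ g al) s1)
... | inj₂ (x ∷ y ∷ xs , s2 , eq , _ , _) = ⊥-elim (length-≤⇒≢++∷ (x ∷ y ∷ xs) (s≤s (s≤s z≤n)) eq)

All-ins : ∀ {N} g l → All (_< N) l → All (_< suc N) (ins g N l)
All-ins {N} zero l al = n<1+n N ∷ All.map m<n⇒m<1+n al
All-ins {N} (suc g) [] [] = n<1+n N ∷ []
All-ins {N} (suc g) (x ∷ l) (p ∷ al) = m<n⇒m<1+n p ∷ All-ins g l al

all-<ᵇ-max : ∀ {N} l → All (_< N) l → all (_<ᵇ N) l ≡ true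
all-<ᵇ-max [] [] = refl
all-<ᵇ-max (x ∷ l) (p ∷ a) rewrite <⇒<ᵇ≡true p = all-<ᵇ-max l a

all-<ᵇ-below-max : ∀ {N x} M → Sub (N ∷ []) M → x < N → all (_<ᵇ x) M ≡ false
all-<ᵇ-below-max {N} {x} (y ∷ M) (skip sb) xN with y <ᵇ x
... | true = all-<ᵇ-below-max {N} {x} M sb xN
... | false = refl
all-<ᵇ-below-max {N} {x} (.N ∷ M) (keep _) xN rewrite ≤⇒<ᵇ≡false {N} {x} (<⇒≤ xN) = refl

rlmax-ins : ∀ {N} j L → All (_< N) L → rlmax (ins j N L) ≡ suc (rlmax (drop j L))
rlmax-ins zero L al rewrite all-<ᵇ-max L al = refl
rlmax-ins (suc j) [] al = refl
rlmax-ins {N} (suc j) (x ∷ L) (p ∷ al) rewrite all-<ᵇ-below-max {N} {x} (ins j N L) (max-Sub-ins N j L) p = rlmax-ins j L al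

rlmax-drop-ins : ∀ {N} g' g0 π → All (_< N) π → g0 ≤ length π →
  rlmax (drop g' (ins g0 N π)) ≡ childProfile (λ g → rlmax (drop g π)) g0 g'
rlmax-drop-ins {N} g' g0 π al gl with ≤-<-connex g' g0
... | inj₁ p rewrite ≤⇒≤ᵇ′ p | drop-ins-≤ g' g0 N π gl p | rlmax-ins (g0 ∸ g') (drop g' π) (drop⁺ g' al)
  = cong (λ t → suc (rlmax t)) (trans (drop-drop g' (g0 ∸ g') π) (cong (λ t → drop t π) (m+[n∸m]≡n p)))
... | inj₂ p rewrite >⇒≤ᵇ′-false p | drop-ins-> g' g0 N π p = refl

∸1-< : ∀ {g' K} → 0 < g' → g' < suc K → g' ∸ 1 < K
∸1-< {suc g'} _ (s≤s p) = p

true⊎false : ∀ (b : Bool) → b ≡ true ⊎ b ≡ false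
true⊎false true = inj₁ refl
true⊎false false = inj₂ refl

module GeneratingTree (τ : ℕ → ℕ → ℕ → Set) (key : ℕ → ℕ → ℕ → ℕ)
  (key-≥ : ∀ {a b c} → τ a b c → a ≤ key a b c × b ≤ key a b c × c ≤ key a b c)
  (key-< : ∀ {a b c N} → τ a b c → a < N → b < N → c < N → key a b c < N)
  (av : List ℕ → Bool)
  (¬av⇒Occ5 : ∀ l → av l ≡ false → Occ5 (Sem τ key) l)
  (Occ5⇒¬av : ∀ l → Occ5 (Sem τ key) l → av l ≡ false) where

  open Insertion τ key key-≥ key-< public

  active : List ℕ → ℕ → Bool
  active π g = av (ins g (suc (length π)) π)

  Valid : List ℕ → Set
  Valid π = Distinct π × All (_< suc (length π)) π × 1 ≤ length π × av π ≡ true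

  ActiveGaps : List ℕ → ℕ → Set
  ActiveGaps π K = K ≤ suc (length π) × (∀ g → g ≤ length π → active π g ≡ true → g < K) × (∀ g → g < K → active π g ≡ true)

  Threshold : List ℕ → ℕ → Set
  Threshold π U = U ≤ length π × (∀ g → g ≤ U → ¬ Occ3 (take g π)) × (∀ g → U < g → g ≤ length π → Occ3 (take g π))

  valid⇒¬Forbidden : ∀ {π} → Valid π → ¬ Forbidden π
  valid⇒¬Forbidden (_ , _ , _ , e) f with trans (sym e) (Occ5⇒¬av _ f)
  ... | ()

  inactive⇒Obstruction : ∀ {π g} → Valid π → active π g ≡ false → Obstruction π g
  inactive⇒Obstruction {π} {g} w e = Forbidden-ins⇒Obstruction g π (proj₁ (proj₂ w)) (valid⇒¬Forbidden w) (¬av⇒Occ5 _ e)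

  Obstruction⇒inactive : ∀ {π g} → Valid π → Obstruction π g → active π g ≡ false
  Obstruction⇒inactive {π} {g} w h = Occ5⇒¬av _ (Obstruction⇒Forbidden-ins g π (proj₁ (proj₂ w)) h)

  ¬Obstruction⇒active : ∀ {π g} → Valid π → ¬ Obstruction π g → active π g ≡ true
  ¬Obstruction⇒active {π} {g} w nh with true⊎false (active π g)
  ... | inj₁ e = e
  ... | inj₂ e = ⊥-elim (nh (inactive⇒Obstruction w e))

  active⇒¬Obstruction : ∀ {π g} → Valid π → active π g ≡ true → ¬ Obstruction π g
  active⇒¬Obstruction w e h with trans (sym e) (Obstruction⇒inactive w h)
  ... | ()

  Valid-ins : ∀ {π g0} → Valid π → active π g0 ≡ true → Valid (ins g0 (suc (length π)) π)
  Valid-ins {π} {g0} (d , a , _ , _) e =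
    Distinct-ins g0 π d a , subst (λ m → All (_< suc m) (ins g0 (suc (length π)) π)) (sym (length-ins g0 _ π)) (All-ins g0 π a) ,
    subst (1 ≤_) (sym (length-ins g0 _ π)) (s≤s z≤n) , e

  short⇒¬Occ3 : ∀ {l} → length l ≤ 2 → ¬ Occ3 l
  short⇒¬Occ3 p (occ3 a b c sb t) = <-irrefl refl (≤-trans (length-Sub sb) p)

  threshold<active : ∀ {π K U} → Valid π → ActiveGaps π K → Threshold π U → U < K
  threshold<active {π} {K} {U} w (_ , sk1 , _) (su0 , su1 , _) = sk1 U su0 (¬Obstruction⇒active w (λ h → su1 U ≤-refl (Obstruction⇒Occ3-take π U h)))

  Obstruction-ins-left⇒threshold< : ∀ {π U g0} → Threshold π U → g0 ≤ length π →
    ∀ g' → g' ≤ g0 → Obstruction (ins g0 (suc (length π)) π) g' → U < g'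
  Obstruction-ins-left⇒threshold< {π} {U} {g0} (_ , su1 , _) g0n g' p h with ≤-<-connex g' U
  ... | inj₁ q = ⊥-elim (su1 g' q (Obstruction-ins-left⁻ g' g0 π g0n p h))
  ... | inj₂ q = q

  ActiveGaps-ins-≤ : ∀ {π K U g0} → Valid π → ActiveGaps π K → Threshold π U → g0 < K → g0 ≤ U →
    ActiveGaps (ins g0 (suc (length π)) π) (suc K)
  ActiveGaps-ins-≤ {π} {K} {U} {g0} w (sk0 , sk1 , sk2) su@(_ , su1 , _) g0<K g0≤U =
    s≤s (subst (K ≤_) (sym lc) sk0) , ka , kb
    where
    n = length π
    N = suc n
    c = ins g0 N π
    lc : length c ≡ suc n
    lc = length-ins g0 N π
    wc : Valid c
    wc = Valid-ins w (sk2 g0 g0<K)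
    g0n : g0 ≤ n
    g0n = ≤-pred (≤-trans g0<K sk0)
    no-obstruction : ∀ g' → g' < suc K → ¬ Obstruction c g'
    no-obstruction g' p h with ≤-<-connex g' g0
    ... | inj₁ q = <-irrefl refl (≤-<-trans (≤-trans q g0≤U) (Obstruction-ins-left⇒threshold< su g0n g' q h))
    ... | inj₂ q with Obstruction-ins-right⁻ g' g0 π (proj₁ (proj₂ w)) g0n q h
    ...   | inj₁ o = su1 g0 g0≤U o
    ...   | inj₂ h' = active⇒¬Obstruction w (sk2 (g' ∸ 1) (∸1-< (≤-<-trans z≤n q) p)) h'
    kb : ∀ g' → g' < suc K → active c g' ≡ true
    kb g' p = ¬Obstruction⇒active wc (no-obstruction g' p)
    ka : ∀ g' → g' ≤ length c → active c g' ≡ true → g' < suc K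
    ka g' p e with ≤-<-connex (suc K) g'
    ... | inj₂ q = q
    ... | inj₁ q = ⊥-elim (active⇒¬Obstruction wc e (Obstruction-ins-right⁺ʳ g' g0 π (<-≤-trans g0<K (≤-trans (n≤1+n K) q)) obstruction-before))
      where
      obstruction-before : Obstruction π (g' ∸ 1)
      obstruction-before with true⊎false (active π (g' ∸ 1))
      ... | inj₂ e' = inactive⇒Obstruction w e'
      ... | inj₁ e' = ⊥-elim (<-irrefl refl (<-≤-trans (sk1 (g' ∸ 1) (∸-monoˡ-≤ 1 (subst (g' ≤_) lc p)) e') (∸-monoˡ-≤ 1 q)))

  ActiveGaps-ins-> : ∀ {π K U g0} → Valid π → ActiveGaps π K → Threshold π U → g0 < K → U < g0 →
    ActiveGaps (ins g0 (suc (length π)) π) (suc U)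
  ActiveGaps-ins-> {π} {K} {U} {g0} w (sk0 , _ , sk2) su@(su0 , _ , su2) g0<K U<g0 =
    s≤s (subst (U ≤_) (sym lc) (≤-trans su0 (n≤1+n n))) , ka , kb
    where
    n = length π
    N = suc n
    c = ins g0 N π
    lc : length c ≡ suc n
    lc = length-ins g0 N π
    wc : Valid c
    wc = Valid-ins w (sk2 g0 g0<K)
    g0n : g0 ≤ n
    g0n = ≤-pred (≤-trans g0<K sk0)
    al = proj₁ (proj₂ w)
    kb : ∀ g' → g' < suc U → active c g' ≡ true
    kb g' p = ¬Obstruction⇒active wc (λ h → <-irrefl refl (<-≤-trans (Obstruction-ins-left⇒threshold< su g0n g' (≤-trans (≤-pred p) (<⇒≤ U<g0)) h) (≤-pred p)))
    ka : ∀ g' → g' ≤ length c → active c g' ≡ true → g' < suc U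
    ka g' p e with ≤-<-connex (suc U) g'
    ... | inj₂ q = q
    ... | inj₁ q with ≤-<-connex g' g0
    ...   | inj₁ r = ⊥-elim (active⇒¬Obstruction wc e (Obstruction-ins-left⁺ g' g0 π al g0n r (su2 g' q (≤-trans r g0n))))
    ...   | inj₂ r = ⊥-elim (active⇒¬Obstruction wc e (Obstruction-ins-right⁺ˡ g' g0 π al (<⇒≤ r) (su2 g0 U<g0 g0n)))

  ActiveGaps-ins : ∀ {π K U g0} → Valid π → ActiveGaps π K → Threshold π U → g0 < K →
    ActiveGaps (ins g0 (suc (length π)) π) (if g0 ≤ᵇ′ U then suc K else suc U)
  ActiveGaps-ins {U = U} {g0} w sk su g0<K with ≤-<-connex g0 U
  ... | inj₁ g0≤U rewrite ≤⇒≤ᵇ′ g0≤U = ActiveGaps-ins-≤ w sk su g0<K g0≤U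
  ... | inj₂ U<g0 rewrite >⇒≤ᵇ′-false U<g0 = ActiveGaps-ins-> w sk su g0<K U<g0

  Threshold-ins-> : ∀ {π U g0} → Threshold π U → U < g0 → g0 ≤ length π → Threshold (ins g0 (suc (length π)) π) U
  Threshold-ins-> {π} {U} {g0} (su0 , su1 , su2) U<g0 g0n =
    subst (U ≤_) (sym (length-ins g0 _ π)) (≤-trans su0 (n≤1+n _)) , ua , ub
    where
    N = suc (length π)
    ua : ∀ g → g ≤ U → ¬ Occ3 (take g (ins g0 N π))
    ua g p o = su1 g p (subst Occ3 (take-ins-≤ g g0 N π g0n (≤-trans p (<⇒≤ U<g0))) o)
    ub : ∀ g → U < g → g ≤ length (ins g0 N π) → Occ3 (take g (ins g0 N π))
    ub g p q with ≤-<-connex g g0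
    ... | inj₁ r = subst Occ3 (sym (take-ins-≤ g g0 N π g0n r)) (su2 g p (≤-trans r g0n))
    ... | inj₂ r with su2 (g ∸ 1) (<-≤-trans U<g0 (∸-monoˡ-≤ 1 r)) (∸-monoˡ-≤ 1 (subst (g ≤_) (length-ins g0 N π) q))
    ... | occ3 a b c sb t = subst Occ3 (sym (take-ins-> g g0 N π g0n r)) (occ3 a b c (Sub-ins g0 N sb) t)

  Σ-active : ∀ {π K} → ActiveGaps π K → (G : ℕ → ℕ) →
    Σ< (suc (length π)) (λ g → if active π g then G g else 0) ≡ Σ< K G
  Σ-active {π} {K} (K≤ , active⇒< , <⇒active) G = begin
    Σ< (suc n) G?
      ≡⟨ cong (λ m → Σ< m G?) (sym (m+[n∸m]≡n K≤)) ⟩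
    Σ< (K + (suc n ∸ K)) G?
      ≡⟨ Σ-split K (suc n ∸ K) G? ⟩
    Σ< K G? + Σ< (suc n ∸ K) (λ i → G? (K + i))
      ≡⟨ cong₂ _+_ (Σ-cong K G? G (λ g g<K → cong (λ b → if b then G g else 0) (<⇒active g g<K))) (Σ-zero (suc n ∸ K) _ inactive) ⟩
    Σ< K G + 0
      ≡⟨ +-identityʳ _ ⟩
    Σ< K G ∎
    where
    n = length π
    G? : ℕ → ℕ
    G? g = if active π g then G g else 0
    inactive : ∀ i → i < suc n ∸ K → G? (K + i) ≡ 0
    inactive i i< with active π (K + i) in e
    ... | false = refl
    ... | true = ⊥-elim (<-irrefl refl (≤-<-trans (m≤m+n K i) (active⇒< (K + i) (≤-pred (subst (K + i <_) (m+[n∸m]≡n K≤) (+-monoʳ-< K i<))) e)))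

  descCoeff-root : ∀ {π K U} → Valid π → ActiveGaps π K → Threshold π U → ∀ k →
    descCoeff rlmax av 0 π k ≡ treeCount 0 K U (λ g → rlmax (drop g π)) k
  descCoeff-root {π} {zero} w (_ , active⇒< , _) _ k with active⇒< 0 z≤n (¬Obstruction⇒active w (λ h → short⇒¬Occ3 z≤n (Obstruction⇒Occ3-take π 0 h)))
  ... | ()
  descCoeff-root {π} {suc K} {zero} w _ (_ , _ , occ3-beyond) k =
    ⊥-elim (short⇒¬Occ3 (≤-trans (length-take≤ 1 π) (s≤s z≤n)) (occ3-beyond 1 (s≤s z≤n) (proj₁ (proj₂ (proj₂ w)))))
  descCoeff-root {π} {suc K} {suc U} _ _ _ k = begin
    coeff rlmax (π ∷ []) k
      ≡⟨ coeff-∷ rlmax π [] k ⟩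
    (if rlmax π ≡ᵇ k then 1 else 0) + 0
      ≡⟨ cong (_+ 0) (sym (shift-Q₀ (rlmax π) k)) ⟩
    shift (rlmax π) (Q 0 0) k + 0
      ≡⟨ cong (shift (rlmax π) (Q 0 0) k +_) (sym (Σ-zero K _ (λ g _ → shift-zero (rlmax (drop (suc g) π)) (Q 0 (suc (g ⊓ U))) k (λ _ → refl)))) ⟩
    treeCount 0 (suc K) (suc U) (λ g → rlmax (drop g π)) k ∎

  module Labels (grow : ℕ → ℕ → ℕ) (grow-≥ : ∀ u g0 → g0 ≤ u → g0 ≤ grow u g0)
    (Σ-Q-grow : ∀ d x u k → Σ< (suc (x ⊓ u)) (λ g0 → Q d (suc x ⊓ grow u g0) k) ≡ Qgap d (x ⊓ u) k)
    (Threshold-ins-≤ : ∀ π U g0 → Valid π → Threshold π U → g0 ≤ U → Threshold (ins g0 (suc (length π)) π) (grow U g0)) where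

    Threshold-ins : ∀ {π U g0} → Valid π → Threshold π U → g0 ≤ length π →
      Threshold (ins g0 (suc (length π)) π) (if g0 ≤ᵇ′ U then grow U g0 else U)
    Threshold-ins {π} {U} {g0} w su g0n with ≤-<-connex g0 U
    ... | inj₁ p rewrite ≤⇒≤ᵇ′ p = Threshold-ins-≤ π U g0 w su p
    ... | inj₂ p rewrite >⇒≤ᵇ′-false p = Threshold-ins-> su p g0n

    descCoeff≡treeCount : ∀ d π K U → Valid π → ActiveGaps π K → Threshold π U → ∀ k →
      descCoeff rlmax av d π k ≡ treeCount d K U (λ g → rlmax (drop g π)) k
    descCoeff≡treeCount zero π K U w sk su k = descCoeff-root w sk su k
    descCoeff≡treeCount (suc d) π K U w sk@(_ , active⇒< , _) su k = begin
      descCoeff rlmax av (suc d) π k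
        ≡⟨ descCoeff-suc rlmax av d π k ⟩
      Σ< (suc n) (λ g → if active π g then descCoeff rlmax av d (ins g N π) k else 0)
        ≡⟨ Σ-cong (suc n) _ _ child ⟩
      Σ< (suc n) (λ g → if active π g then G g else 0)
        ≡⟨ Σ-active sk G ⟩
      Σ< K G
        ≡⟨ cong (λ m → Σ< m G) (sym (m+[n∸m]≡n U<K)) ⟩
      Σ< (suc U + (K ∸ suc U)) G
        ≡⟨ Σ-split (suc U) (K ∸ suc U) G ⟩
      Σ< (suc U) G + Σ< (K ∸ suc U) (λ i → G (suc U + i))
        ≡⟨ cong₂ _+_ (Σ-cong (suc U) G _ (λ g g≤U → cong (λ b → G′ b g) (≤⇒≤ᵇ′ (≤-pred g≤U))))
                     (Σ-cong (K ∸ suc U) _ _ (λ i _ → cong (λ b → G′ b (suc U + i)) (>⇒≤ᵇ′-false (s≤s (m≤m+n U i))))) ⟩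
      Σ< (suc U) (λ g → treeCount d (suc K) (grow U g) (childProfile ρ g) k)
        + Σ< (K ∸ suc U) (λ i → treeCount d (suc U) U (childProfile ρ (suc U + i)) k)
        ≡⟨ treeCount-suc d K U ρ (grow U) k U<K (grow-≥ U) (λ x _ k → Σ-Q-grow d x U k) ⟩
      treeCount (suc d) K U ρ k ∎
      where
      n = length π
      N = suc n
      ρ : ℕ → ℕ
      ρ g = rlmax (drop g π)
      U<K = threshold<active w sk su
      G′ : Bool → ℕ → ℕ
      G′ b g = treeCount d (if b then suc K else suc U) (if b then grow U g else U) (childProfile ρ g) k
      G : ℕ → ℕ
      G g = G′ (g ≤ᵇ′ U) g
      child : ∀ g → g < suc n → (if active π g then descCoeff rlmax av d (ins g N π) k else 0) ≡ (if active π g then G g else 0)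
      child g g≤n with active π g in e
      ... | false = refl
      ... | true = trans (descCoeff≡treeCount d (ins g N π) _ _ (Valid-ins w e) (ActiveGaps-ins w sk su (active⇒< g (≤-pred g≤n) e)) (Threshold-ins w su (≤-pred g≤n)) k)
                         (treeCount-cong d (if g ≤ᵇ′ U then suc K else suc U) (if g ≤ᵇ′ U then grow U g else U) _ _ k (λ g' → rlmax-drop-ins g' g π (proj₁ (proj₂ w)) (≤-pred g≤n)))

    descCoeff-[1] : av (1 ∷ []) ≡ true → av (2 ∷ 1 ∷ []) ≡ true → av (1 ∷ 2 ∷ []) ≡ true →
      ∀ d k → descCoeff rlmax av d (1 ∷ []) k ≡ treeCount d 2 1 (λ g → rlmax (drop g (1 ∷ []))) k
    descCoeff-[1] root gap₀ gap₁ d k = descCoeff≡treeCount d (1 ∷ []) 2 1 valid active-gaps threshold k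
      where
      valid : Valid (1 ∷ [])
      valid = (λ { b c (skip ()) ; b c (keep ()) }) , s≤s (s≤s z≤n) ∷ [] , s≤s z≤n , root
      active-gaps : ActiveGaps (1 ∷ []) 2
      active-gaps = ≤-refl , (λ g g≤1 _ → s≤s g≤1) , λ { zero _ → gap₀ ; (suc zero) _ → gap₁ ; (suc (suc g)) (s≤s (s≤s ())) }
      threshold : Threshold (1 ∷ []) 1
      threshold = ≤-refl , (λ g g≤1 → short⇒¬Occ3 (≤-trans (length-take≤ g (1 ∷ [])) (≤-trans g≤1 (s≤s z≤n)))) , λ g 1<g g≤1 → ⊥-elim (<-irrefl refl (<-≤-trans 1<g g≤1))

keyB-≥ : ∀ {a b c} → τB a b c → a ≤ keyB a b c × b ≤ keyB a b c × c ≤ keyB a b c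
keyB-≥ (ba , ca , _) = ≤-refl , <⇒≤ ba , <⇒≤ ca

keyB-< : ∀ {a b c N} → τB a b c → a < N → b < N → c < N → keyB a b c < N
keyB-< _ p _ _ = p

keyA-≥ : ∀ {a b c} → τA a b c → a ≤ keyA a b c × b ≤ keyA a b c × c ≤ keyA a b c
keyA-≥ (ac , bc , _) = <⇒≤ ac , <⇒≤ bc , ≤-refl

keyA-< : ∀ {a b c N} → τA a b c → a < N → b < N → c < N → keyA a b c < N
keyA-< _ _ _ p = p

module TreeA = GeneratingTree τA keyA keyA-≥ keyA-< (avoidsAll pats₁ᶜ) (λ l → avoidsAll-false⇒Occ5 pats₁ᶜ l decodesA) (λ l → OccA⇒¬avoidsA)

module TreeB = GeneratingTree τB keyB keyB-≥ keyB-< (avoidsAll pats₂) (λ l → avoidsAll-false⇒Occ5 pats₂ l decodesB) (λ l → OccB⇒¬avoidsB)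

length≥2⁻ : ∀ (X : List ℕ) → 2 ≤ length X → Σ ℕ λ b → Σ ℕ λ c → Σ (List ℕ) λ r → X ≡ b ∷ c ∷ r
length≥2⁻ (b ∷ c ∷ r) _ = b , c , r , refl
length≥2⁻ (b ∷ []) (s≤s ())

Occ3B-ins⁻ : ∀ {N} g0 L → All (_< N) L → TreeB.Occ3 (ins g0 N L) → TreeB.Occ3 L ⊎ 2 ≤ length (drop g0 L)
Occ3B-ins⁻ {N} g0 L al (TreeB.occ3 a b c sb t) rewrite ins≡take++drop g0 N L with Sub-mid (take g0 L) sb
... | inj₁ sb' = inj₁ (TreeB.occ3 a b c (subst (Sub _) (take++drop≡id g0 L) sb') t)
... | inj₂ ([] , .(b ∷ c ∷ []) , refl , _ , s2) = inj₂ (length-Sub s2)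
... | inj₂ (.a ∷ [] , .(c ∷ []) , refl , s1 , _) = ⊥-elim (<-asym (proj₁ t) (All-Sub-singleton (take⁺ g0 al) s1))
... | inj₂ (.a ∷ .b ∷ [] , .[] , refl , s1 , _) = ⊥-elim (<-asym (proj₁ (proj₂ t)) (All-Sub-singleton (take⁺ g0 al) (Sub-trans (keep ([]-Sub _)) s1)))
... | inj₂ (x ∷ y ∷ z ∷ xs , s2 , eq , _ , _) = ⊥-elim (length-≤⇒≢++∷ (x ∷ y ∷ z ∷ xs) (s≤s (s≤s (s≤s z≤n))) eq)

Occ3B-ins⁺ : ∀ {N} g0 L → All (_< N) L → Distinct L → 2 ≤ length (drop g0 L) → TreeB.Occ3 (ins g0 N L)
Occ3B-ins⁺ {N} g0 L al dl p with length≥2⁻ (drop g0 L) p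
... | b , c , r , e = subst TreeB.Occ3 (sym (ins≡take++drop g0 N L))
      (TreeB.occ3 N b c (Sub-++l (take g0 L) (keep sbc)) (bN , cN , dl b c (Sub-drop g0 L sbc)))
  where
  ad = drop⁺ g0 al
  sbc : Sub (b ∷ c ∷ []) (drop g0 L)
  sbc = subst (Sub _) (sym e) (keep (keep ([]-Sub r)))
  bN : b < N
  bN = All-Sub-singleton ad (subst (Sub _) (sym e) (keep ([]-Sub _)))
  cN : c < N
  cN = All-Sub-singleton ad (subst (Sub _) (sym e) (skip (keep ([]-Sub _))))

Occ3A-ins⁻ : ∀ {N} g0 L → All (_< N) L → TreeA.Occ3 (ins g0 N L) → TreeA.Occ3 L ⊎ 2 ≤ length (take g0 L)
Occ3A-ins⁻ {N} g0 L al (TreeA.occ3 a b c sb t) rewrite ins≡take++drop g0 N L with Sub-mid (take g0 L) sb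
... | inj₁ sb' = inj₁ (TreeA.occ3 a b c (subst (Sub _) (take++drop≡id g0 L) sb') t)
... | inj₂ ([] , .(b ∷ c ∷ []) , refl , _ , s2) = ⊥-elim (<-asym (proj₁ t) (All-Sub-singleton (drop⁺ g0 al) (Sub-trans (skip (keep ([]-Sub _))) s2)))
... | inj₂ (.a ∷ [] , .(c ∷ []) , refl , s1 , s2) = ⊥-elim (<-asym (proj₁ (proj₂ t)) (All-Sub-singleton (drop⁺ g0 al) s2))
... | inj₂ (.a ∷ .b ∷ [] , .[] , refl , s1 , _) = inj₂ (length-Sub s1)
... | inj₂ (x ∷ y ∷ z ∷ xs , s2 , eq , _ , _) = ⊥-elim (length-≤⇒≢++∷ (x ∷ y ∷ z ∷ xs) (s≤s (s≤s (s≤s z≤n))) eq)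

Occ3A-ins⁺ : ∀ {N} g0 L → All (_< N) L → Distinct L → 2 ≤ length (take g0 L) → TreeA.Occ3 (ins g0 N L)
Occ3A-ins⁺ {N} g0 L al dl p with length≥2⁻ (take g0 L) p
... | a , b , r , e = subst TreeA.Occ3 (sym (ins≡take++drop g0 N L))
      (TreeA.occ3 a b N (Sub-++ sab (keep ([]-Sub _))) (aN , bN , dl a b (Sub-take⇒Sub g0 L sab)))
  where
  at = take⁺ g0 al
  sab : Sub (a ∷ b ∷ []) (take g0 L)
  sab = subst (Sub _) (sym e) (keep (keep ([]-Sub r)))
  aN : a < N
  aN = All-Sub-singleton at (subst (Sub _) (sym e) (keep ([]-Sub _)))
  bN : b < N
  bN = All-Sub-singleton at (subst (Sub _) (sym e) (skip (keep ([]-Sub _))))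

Distinct-take : ∀ g l → Distinct l → Distinct (take g l)
Distinct-take g l d b c sb = d b c (Sub-take⇒Sub g l sb)

length-take≡ : ∀ m (l : List ℕ) → m ≤ length l → length (take m l) ≡ m
length-take≡ m l p = trans (length-take m l) (m≤n⇒m⊓n≡m p)

¬Occ3B-ins-short : ∀ π U g0 → TreeB.Valid π → TreeB.Threshold π U → g0 ≤ U →
  ∀ g' → g' ≤ growB U g0 → ¬ TreeB.Occ3 (take g' (ins g0 (suc (length π)) π))
¬Occ3B-ins-short π U g0 w (su0 , su1 , _) g0≤U g' p o with ≤-<-connex g' g0
... | inj₁ q = su1 g' (≤-trans q g0≤U) (subst TreeB.Occ3 (take-ins-≤ g' g0 _ π g0n q) o)
  where
  g0n = ≤-trans g0≤U su0
... | inj₂ q with Occ3B-ins⁻ g0 (take (g' ∸ 1) π) (take⁺ (g' ∸ 1) (proj₁ (proj₂ w))) (subst TreeB.Occ3 (take-ins-> g' g0 _ π (≤-trans g0≤U su0) q) o)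
...   | inj₁ o' = su1 (g' ∸ 1) (∸-monoˡ-≤ 1 (≤-trans p (m⊓n≤m (suc U) (2 + g0)))) o'
...   | inj₂ two = <-irrefl refl (≤-<-trans two≤one (s≤s (s≤s z≤n)))
  where
  two≤one : 2 ≤ 1
  two≤one = ≤-trans two (≤-trans (≤-reflexive (length-drop g0 (take (g' ∸ 1) π)))
              (≤-trans (∸-monoˡ-≤ g0 (length-take≤ (g' ∸ 1) π))
              (≤-trans (∸-monoˡ-≤ g0 (∸-monoˡ-≤ 1 (≤-trans p (m⊓n≤n (suc U) (2 + g0)))))
              (≤-reflexive (m+n∸n≡m 1 g0)))))

Occ3B-ins-long : ∀ π U g0 → TreeB.Valid π → TreeB.Threshold π U → g0 ≤ U →
  ∀ g' → growB U g0 < g' → g' ≤ length (ins g0 (suc (length π)) π) → TreeB.Occ3 (take g' (ins g0 (suc (length π)) π))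
Occ3B-ins-long π U g0 w (su0 , _ , su2) g0≤U g' p q = subst TreeB.Occ3 (sym (take-ins-> g' g0 N π g0n g0<g')) body
  where
  n = length π
  N = suc n
  g0n : g0 ≤ n
  g0n = ≤-trans g0≤U su0
  g0<g' : g0 < g'
  g0<g' = ≤-trans (⊓-glb (s≤s g0≤U) (n≤1+n (suc g0))) (<⇒≤ p)
  g'1n : g' ∸ 1 ≤ n
  g'1n = ∸-monoˡ-≤ 1 (subst (g' ≤_) (length-ins g0 N π) q)
  body : TreeB.Occ3 (ins g0 N (take (g' ∸ 1) π))
  body with ≤-<-connex (g' ∸ 1) U
  ... | inj₂ r with su2 (g' ∸ 1) r g'1n
  ...   | TreeB.occ3 a b c sb t = TreeB.occ3 a b c (Sub-ins g0 N sb) t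
  body | inj₁ r = Occ3B-ins⁺ g0 (take (g' ∸ 1) π) (take⁺ (g' ∸ 1) (proj₁ (proj₂ w))) (Distinct-take (g' ∸ 1) π (proj₁ w)) two
    where
    g'≤sU : g' ≤ suc U
    g'≤sU = ∸1-≤⇒≤suc g' r
      where
      ∸1-≤⇒≤suc : ∀ x → x ∸ 1 ≤ U → x ≤ suc U
      ∸1-≤⇒≤suc zero _ = z≤n
      ∸1-≤⇒≤suc (suc x) h = s≤s h
    big : 2 + g0 < g'
    big with ≤-<-connex g' (2 + g0)
    ... | inj₂ s = s
    ... | inj₁ s = ⊥-elim (<-irrefl refl (<-≤-trans p (⊓-glb g'≤sU s)))
    two : 2 ≤ length (drop g0 (take (g' ∸ 1) π))
    two = subst (2 ≤_) (sym (trans (length-drop g0 (take (g' ∸ 1) π)) (cong (_∸ g0) (length-take≡ (g' ∸ 1) π g'1n))))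
            (subst (_≤ (g' ∸ 1) ∸ g0) (m+n∸n≡m 2 g0) (∸-monoˡ-≤ g0 (∸-monoˡ-≤ 1 big)))

Threshold-ins-≤B : ∀ π U g0 → TreeB.Valid π → TreeB.Threshold π U → g0 ≤ U →
  TreeB.Threshold (ins g0 (suc (length π)) π) (growB U g0)
Threshold-ins-≤B π U g0 w su@(su0 , _ , _) g0≤U =
  subst (growB U g0 ≤_) (sym (length-ins g0 _ π)) (≤-trans (m⊓n≤m (suc U) (2 + g0)) (s≤s su0)) ,
  ¬Occ3B-ins-short π U g0 w su g0≤U , Occ3B-ins-long π U g0 w su g0≤U

Threshold-ins-≤A-≤1 : ∀ π U g0 → TreeA.Valid π → TreeA.Threshold π U → g0 ≤ U → g0 ≤ 1 →
  TreeA.Threshold (ins g0 (suc (length π)) π) (suc U)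
Threshold-ins-≤A-≤1 π U g0 w (su0 , su1 , su2) g0≤U g0≤1 = i , ii , iii
  where
  n = length π
  N = suc n
  c = ins g0 N π
  lc : length c ≡ suc n
  lc = length-ins g0 N π
  g0n : g0 ≤ n
  g0n = ≤-trans g0≤U su0
  i : suc U ≤ length c
  i = subst (suc U ≤_) (sym lc) (s≤s su0)
  ii : ∀ g' → g' ≤ suc U → ¬ TreeA.Occ3 (take g' c)
  ii g' p o with ≤-<-connex g' g0
  ... | inj₁ q = su1 g' (≤-trans q g0≤U) (subst TreeA.Occ3 (take-ins-≤ g' g0 N π g0n q) o)
  ... | inj₂ q with Occ3A-ins⁻ g0 (take (g' ∸ 1) π) (take⁺ (g' ∸ 1) (proj₁ (proj₂ w))) (subst TreeA.Occ3 (take-ins-> g' g0 N π g0n q) o)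
  ...   | inj₁ o' = su1 (g' ∸ 1) (∸-monoˡ-≤ 1 p) o'
  ...   | inj₂ two = <-irrefl refl (≤-<-trans (≤-trans two (≤-trans (length-take≤ g0 _) g0≤1)) (s≤s (s≤s z≤n)))
  iii : ∀ g' → suc U < g' → g' ≤ length c → TreeA.Occ3 (take g' c)
  iii g' p q with su2 (g' ∸ 1) (∸-monoˡ-≤ 1 p) (∸-monoˡ-≤ 1 (subst (g' ≤_) lc q))
  ... | TreeA.occ3 a b c' sb t = subst TreeA.Occ3 (sym (take-ins-> g' g0 N π g0n (<-trans (s≤s g0≤U) p))) (TreeA.occ3 a b c' (Sub-ins g0 N sb) t)

Threshold-ins-≤A->1 : ∀ π U g0 → TreeA.Valid π → TreeA.Threshold π U → g0 ≤ U → 1 < g0 →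
  TreeA.Threshold (ins g0 (suc (length π)) π) g0
Threshold-ins-≤A->1 π U g0 w (su0 , su1 , su2) g0≤U 1<g0 = i , ii , iii
  where
  n = length π
  N = suc n
  c = ins g0 N π
  lc : length c ≡ suc n
  lc = length-ins g0 N π
  g0n : g0 ≤ n
  g0n = ≤-trans g0≤U su0
  i : g0 ≤ length c
  i = subst (g0 ≤_) (sym lc) (≤-trans g0n (n≤1+n n))
  ii : ∀ g' → g' ≤ g0 → ¬ TreeA.Occ3 (take g' c)
  ii g' p o = su1 g' (≤-trans p g0≤U) (subst TreeA.Occ3 (take-ins-≤ g' g0 N π g0n p) o)
  iii : ∀ g' → g0 < g' → g' ≤ length c → TreeA.Occ3 (take g' c)
  iii g' p q = subst TreeA.Occ3 (sym (take-ins-> g' g0 N π g0n p))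
    (Occ3A-ins⁺ g0 (take (g' ∸ 1) π) (take⁺ (g' ∸ 1) (proj₁ (proj₂ w))) (Distinct-take (g' ∸ 1) π (proj₁ w)) two)
    where
    g'1n : g' ∸ 1 ≤ n
    g'1n = ∸-monoˡ-≤ 1 (subst (g' ≤_) lc q)
    two : 2 ≤ length (take g0 (take (g' ∸ 1) π))
    two = subst (2 ≤_) (sym (length-take≡ g0 (take (g' ∸ 1) π) (subst (g0 ≤_) (sym (length-take≡ (g' ∸ 1) π g'1n)) (∸-monoˡ-≤ 1 p)))) 1<g0

Threshold-ins-≤A : ∀ π U g0 → TreeA.Valid π → TreeA.Threshold π U → g0 ≤ U →
  TreeA.Threshold (ins g0 (suc (length π)) π) (growA U g0)
Threshold-ins-≤A π U g0 w su g0≤U with ≤-<-connex g0 1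
... | inj₁ g0≤1 rewrite ≤⇒≤ᵇ′ g0≤1 = Threshold-ins-≤A-≤1 π U g0 w su g0≤U g0≤1
... | inj₂ 1<g0 rewrite >⇒≤ᵇ′-false 1<g0 = Threshold-ins-≤A->1 π U g0 w su g0≤U 1<g0

module CountA = TreeA.Labels growA growA-≥ Σ-Q-growA Threshold-ins-≤A

module CountB = TreeB.Labels growB growB-≥ Σ-Q-growB Threshold-ins-≤B

equidistributed-rlmax : ∀ n → 1 ≤ n → ∀ k → coeff rlmax (Av n pats₁ᶜ) k ≡ coeff rlmax (Av n pats₂) k
equidistributed-rlmax (suc d) _ k = begin
  coeff rlmax (Av (suc d) pats₁ᶜ) k
    ≡⟨ cong (λ L → coeff rlmax L k) (Av≡descendants pats₁ᶜ d refl) ⟩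
  descCoeff rlmax (avoidsAll pats₁ᶜ) d (1 ∷ []) k
    ≡⟨ CountA.descCoeff-[1] refl refl refl d k ⟩
  treeCount d 2 1 (λ g → rlmax (drop g (1 ∷ []))) k
    ≡⟨ sym (CountB.descCoeff-[1] refl refl refl d k) ⟩
  descCoeff rlmax (avoidsAll pats₂) d (1 ∷ []) k
    ≡⟨ cong (λ L → coeff rlmax L k) (sym (Av≡descendants pats₂ d refl)) ⟩
  coeff rlmax (Av (suc d) pats₂) k ∎

InRange : ℕ → ℕ → Set
InRange n x = 1 ≤ x × x ≤ n

desc-[n] : ℕ → List ℕ
desc-[n] zero = []
desc-[n] (suc n) = suc n ∷ desc-[n] n

∈-insertions⁻ : ∀ N l {x} → x ∈ insertions N l → Σ ℕ λ g → x ≡ ins g N l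
∈-insertions⁻ N [] (here e) = 0 , e
∈-insertions⁻ N (y ∷ ys) (here e) = 0 , e
∈-insertions⁻ N (y ∷ ys) (there m) with ∈-map⁻ (y ∷_) m
... | t , m' , refl with ∈-insertions⁻ N ys m'
... | g , refl = suc g , refl

∈-insertions⁺ : ∀ N l g → g ≤ length l → ins g N l ∈ insertions N l
∈-insertions⁺ N l zero _ with l
... | [] = here refl
... | y ∷ ys = here refl
∈-insertions⁺ N (y ∷ ys) (suc g) (s≤s p) = there (∈-map⁺ (y ∷_) (∈-insertions⁺ N ys g p))

ins-↭ : ∀ g N l → ins g N l ↭ N ∷ l
ins-↭ zero N l = ↭-refl
ins-↭ (suc g) N [] = ↭-refl
ins-↭ (suc g) N (x ∷ l) = ↭-trans (prep x (ins-↭ g N l)) (swap x N ↭-refl)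

perms→↭ : ∀ n π → π ∈ perms n → π ↭ desc-[n] n
perms→↭ zero π (here refl) = ↭-refl
perms→↭ (suc n) π m with find (∈-concatMap⁻ (insertions (suc n)) m)
... | ρ , mρ , mi with ∈-insertions⁻ (suc n) ρ mi
... | g , refl = ↭-trans (ins-↭ g (suc n) ρ) (prep (suc n) (perms→↭ n ρ mρ))

↭→perms : ∀ n π → π ↭ desc-[n] n → π ∈ perms n
↭→perms zero π p rewrite ↭-empty-inv p = here refl
↭→perms (suc n) π p with ∈-∃++ (∈-resp-↭ (↭-sym p) (here refl))
... | P , S , refl = ∈-concatMap⁺ (insertions (suc n)) (lose (↭→perms n (P ++ S) p') mem)
  where
  p' : P ++ S ↭ desc-[n] n
  p' = drop-mid P [] p
  mem : P ++ [ suc n ] ++ S ∈ insertions (suc n) (P ++ S)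
  mem = subst (_∈ insertions (suc n) (P ++ S)) (trans (ins-++r P S (length P) (suc n) ≤-refl) (cong (λ t → P ++ ins t (suc n) S) (n∸n≡0 (length P))))
          (∈-insertions⁺ (suc n) (P ++ S) (length P) (subst (length P ≤_) (sym (length-++ P)) (m≤m+n (length P) (length S))))

∈-desc-[n] : ∀ n {x} → x ∈ desc-[n] n → InRange n x
∈-desc-[n] (suc n) (here refl) = s≤s z≤n , ≤-refl
∈-desc-[n] (suc n) (there m) with ∈-desc-[n] n m
... | a , b = a , m≤n⇒m≤1+n b

perms-range : ∀ n π → π ∈ perms n → All (InRange n) π
perms-range n π m = All.tabulate (λ mx → ∈-desc-[n] n (∈-resp-↭ (perms→↭ n π m) mx))

Unique-insertions : ∀ N l → All (_≢ N) l → Unique (insertions N l)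
Unique-insertions N [] [] = [] ∷ []
Unique-insertions N (y ∷ ys) (yN ∷ a) = All-map⁺ {P = λ t → (N ∷ y ∷ ys) ≢ t} (All.tabulate (λ {t} _ e → yN (sym (proj₁ (∷-injective e)))))
  ∷ UP.map⁺ (λ {u} {v} e → proj₂ (∷-injective e)) (Unique-insertions N ys a)

delete : ℕ → List ℕ → List ℕ
delete N [] = []
delete N (x ∷ l) = if x ≡ᵇ N then l else x ∷ delete N l

≡ᵇ-refl : ∀ n → (n ≡ᵇ n) ≡ true
≡ᵇ-refl zero = refl
≡ᵇ-refl (suc n) = ≡ᵇ-refl n

delete-ins : ∀ N g l → All (_≢ N) l → delete N (ins g N l) ≡ l
delete-ins N zero l _ rewrite ≡ᵇ-refl N = refl
delete-ins N (suc g) [] _ rewrite ≡ᵇ-refl N = refl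
delete-ins N (suc g) (x ∷ l) (xN ∷ a) with x ≡ᵇ N in e
... | true = ⊥-elim (xN (≡ᵇ⇒≡ x N (subst T (sym e) _)))
... | false = cong (x ∷_) (delete-ins N g l a)

Disjoint-ins : ∀ N l l' → All (_≢ N) l → All (_≢ N) l' → l ≢ l' → Disjoint (insertions N l) (insertions N l')
Disjoint-ins N l l' a a' ne (m , m') with ∈-insertions⁻ N l m | ∈-insertions⁻ N l' m'
... | g , e | g' , e' = ne (trans (sym (delete-ins N g l a)) (trans (cong (delete N) (trans (sym e) e')) (delete-ins N g' l' a')))

AllPairs-map : ∀ {Q : List ℕ → Set} {R : List (List ℕ) → List (List ℕ) → Set} (f : List ℕ → List (List ℕ)) xs → AllPairs _≢_ xs → All Q xs →
  (∀ x y → Q x → Q y → x ≢ y → R (f x) (f y)) → AllPairs R (map f xs)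
AllPairs-map f [] [] [] h = []
AllPairs-map {Q} {R} f (x ∷ xs) (px ∷ ap) (qx ∷ aq) h = go xs px aq ∷ AllPairs-map f xs ap aq h
  where
  go : ∀ ys → All (x ≢_) ys → All Q ys → All (R (f x)) (map f ys)
  go [] [] [] = []
  go (y ∷ ys) (p ∷ ps) (q ∷ qs) = h x y qx q p ∷ go ys ps qs

max∉perms : ∀ n π → π ∈ perms n → All (_≢ suc n) π
max∉perms n π m = All.tabulate (λ mx e → <-irrefl refl (subst (_≤ n) e (proj₂ (∈-desc-[n] n (∈-resp-↭ (perms→↭ n π m) mx)))))

Unique-perms : ∀ n → Unique (perms n)
Unique-perms zero = [] ∷ []
Unique-perms (suc n) = UP.concat⁺ (All-map⁺ (All.tabulate (λ m → Unique-insertions (suc n) _ (max∉perms n _ m))))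
  (AllPairs-map (insertions (suc n)) (perms n) (Unique-perms n) (All.tabulate (λ {x} m → max∉perms n x m))
    (λ x y qx qy ne → Disjoint-ins (suc n) x y qx qy ne))

complement : ℕ → ℕ → ℕ
complement n x = suc n ∸ x

complementPerm : ℕ → List ℕ → List ℕ
complementPerm n = map (complement n)

complement-involutive : ∀ n x → x ≤ suc n → complement n (complement n x) ≡ x
complement-involutive n x p = m∸[m∸n]≡n p

complementPerm-involutive : ∀ n π → All (InRange n) π → complementPerm n (complementPerm n π) ≡ π
complementPerm-involutive n [] [] = refl
complementPerm-involutive n (x ∷ π) ((_ , p) ∷ a) = cong₂ _∷_ (complement-involutive n x (m≤n⇒m≤1+n p)) (complementPerm-involutive n π a)

asc-[n] : ℕ → List ℕ
asc-[n] zero = []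
asc-[n] (suc n) = 1 ∷ map suc (asc-[n] n)

All-≤-desc-[n] : ∀ n → All (_≤ n) (desc-[n] n)
All-≤-desc-[n] zero = []
All-≤-desc-[n] (suc n) = ≤-refl ∷ All.map m≤n⇒m≤1+n (All-≤-desc-[n] n)

complement-suc : ∀ m l → All (_≤ m) l → map (complement (suc m)) l ≡ map suc (map (complement m) l)
complement-suc m [] [] = refl
complement-suc m (x ∷ l) (p ∷ a) = cong₂ _∷_ (+-∸-assoc 1 (m≤n⇒m≤1+n p)) (complement-suc m l a)

complement-desc : ∀ n → map (complement n) (desc-[n] n) ≡ asc-[n] n
complement-desc zero = refl
complement-desc (suc n) = cong₂ _∷_ (m+n∸n≡m 1 n) (trans (complement-suc n (desc-[n] n) (All-≤-desc-[n] n)) (cong (map suc) (complement-desc n)))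

desc-[n]-suc : ∀ n → desc-[n] (suc n) ≡ map suc (desc-[n] n) ++ (1 ∷ [])
desc-[n]-suc zero = refl
desc-[n]-suc (suc n) = cong (suc (suc n) ∷_) (desc-[n]-suc n)

asc↭desc : ∀ n → asc-[n] n ↭ desc-[n] n
asc↭desc zero = ↭-refl
asc↭desc (suc n) = ↭-trans (prep 1 (map⁺ suc (asc↭desc n))) (↭-trans (++-comm (1 ∷ []) (map suc (desc-[n] n))) (subst (λ t → map suc (desc-[n] n) ++ (1 ∷ []) ↭ t) (sym (desc-[n]-suc n)) ↭-refl))

complement-∈-perms : ∀ n π → π ∈ perms n → complementPerm n π ∈ perms n
complement-∈-perms n π m = ↭→perms n (complementPerm n π) (↭-trans (map⁺ (complement n) (perms→↭ n π m)) (subst (_↭ desc-[n] n) (sym (complement-desc n)) (asc↭desc n)))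

Unique-map-complementPerm : ∀ n (xs : List (List ℕ)) → Unique xs → All (λ π → All (InRange n) π) xs → Unique (map (complementPerm n) xs)
Unique-map-complementPerm n [] [] [] = []
Unique-map-complementPerm n (x ∷ xs) (px ∷ u) (ax ∷ a) = go xs px a ∷ Unique-map-complementPerm n xs u a
  where
  go : ∀ ys → All (x ≢_) ys → All (λ π → All (InRange n) π) ys → All (complementPerm n x ≢_) (map (complementPerm n) ys)
  go [] [] [] = []
  go (y ∷ ys) (p ∷ ps) (ay ∷ as) = (λ e → p (trans (sym (complementPerm-involutive n x ax)) (trans (cong (complementPerm n) e) (complementPerm-involutive n y ay)))) ∷ go ys ps as

All-range-perms : ∀ n → All (λ π → All (InRange n) π) (perms n)
All-range-perms n = All.tabulate (λ {π} m → perms-range n π m)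

complement-↭ : ∀ n → map (complementPerm n) (perms n) ↭ perms n
complement-↭ n = ∼bag⇒↭ (unique∧set⇒bag (Unique-map-complementPerm n (perms n) (Unique-perms n) (All-range-perms n)) (Unique-perms n)
  (λ {v} → mk⇔ (to v) (from v)))
  where
  to : ∀ v → v ∈ map (complementPerm n) (perms n) → v ∈ perms n
  to v m with ∈-map⁻ (complementPerm n) m
  ... | π , mπ , refl = complement-∈-perms n π mπ
  from : ∀ v → v ∈ perms n → v ∈ map (complementPerm n) (perms n)
  from v m = subst (_∈ map (complementPerm n) (perms n)) (complementPerm-involutive n v (perms-range n v m)) (∈-map⁺ (complementPerm n) (complement-∈-perms n v m))

complement-reverses-< : ∀ n {x y} → y ≤ suc n → x < y → complement n y < complement n x
complement-reverses-< n y≤ x<y = ∸-monoʳ-< x<y y≤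

complement-reverses-<⁻ : ∀ n {x y} → x ≤ suc n → complement n y < complement n x → x < y
complement-reverses-<⁻ n {x} {y} px p with <-cmp x y
... | tri< q _ _ = q
... | tri≈ _ refl _ = ⊥-elim (<-irrefl refl p)
... | tri> _ _ q = ⊥-elim (<-asym p (complement-reverses-< n px q))

complement-injective : ∀ n {x y} → x ≤ suc n → y ≤ suc n → complement n x ≡ complement n y → x ≡ y
complement-injective n {x} {y} px py e = trans (sym (complement-involutive n x px)) (trans (cong (complement n) e) (complement-involutive n y py))

complement-<ᵇ : ∀ n {x y} → x ≤ suc n → y ≤ suc n → (complement n y <ᵇ complement n x) ≡ (x <ᵇ y)
complement-<ᵇ n {x} {y} px py with <-cmp x y
... | tri< q _ _ = trans (<⇒<ᵇ≡true (complement-reverses-< n py q)) (sym (<⇒<ᵇ≡true q))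
... | tri≈ _ refl _ = trans (≤⇒<ᵇ≡false {complement n x} {complement n x} ≤-refl) (sym (≤⇒<ᵇ≡false {x} {x} ≤-refl))
... | tri> _ _ q = trans (≤⇒<ᵇ≡false (<⇒≤ (complement-reverses-< n px q))) (sym (≤⇒<ᵇ≡false (<⇒≤ q)))

InRange⇒≤suc : ∀ {n x} → InRange n x → x ≤ suc n
InRange⇒≤suc (_ , p) = m≤n⇒m≤1+n p

all-complement : ∀ n x xs → InRange n x → All (InRange n) xs → all (_<ᵇ complement n x) (map (complement n) xs) ≡ all (x <ᵇ_) xs
all-complement n x [] rx [] = refl
all-complement n x (y ∷ xs) rx (ry ∷ a) = cong₂ _∧_ (complement-<ᵇ n (InRange⇒≤suc rx) (InRange⇒≤suc ry)) (all-complement n x xs rx a)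

rlmax-complement : ∀ n π → All (InRange n) π → rlmax (complementPerm n π) ≡ rlmin π
rlmax-complement n [] [] = refl
rlmax-complement n (x ∷ π) (rx ∷ a) rewrite all-complement n x π rx a | rlmax-complement n π a = refl

Sub-map⁺ : ∀ (f : ℕ → ℕ) {s l} → Sub s l → Sub (map f s) (map f l)
Sub-map⁺ f sub[] = sub[]
Sub-map⁺ f (skip sb) = skip (Sub-map⁺ f sb)
Sub-map⁺ f (keep sb) = keep (Sub-map⁺ f sb)

Sub-map⁻ : ∀ (f : ℕ → ℕ) {s'} l → Sub s' (map f l) → Σ (List ℕ) λ s → Sub s l × s' ≡ map f s
Sub-map⁻ f [] sub[] = [] , sub[] , refl
Sub-map⁻ f (x ∷ l) (skip sb) with Sub-map⁻ f l sb
... | s , sb' , e = s , skip sb' , e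
Sub-map⁻ f (x ∷ l) (keep sb) with Sub-map⁻ f l sb
... | s , sb' , e = x ∷ s , keep sb' , cong (f x ∷_) e

InRange-occ5 : ∀ {n a b c d e l} → All (InRange n) l → Sub (a ∷ b ∷ c ∷ d ∷ e ∷ []) l → InRange n a × InRange n b × InRange n c × InRange n d × InRange n e
InRange-occ5 al sb with Sub-all al sb
... | ra ∷ rb ∷ rc ∷ rd ∷ re ∷ [] = ra , rb , rc , rd , re

Occ₁⇒OccA-complement : ∀ n π → All (InRange n) π → Occ5 Sem₁ π → Occ5 (Sem τA keyA) (complementPerm n π)
Occ₁⇒OccA-complement n π al (occ5 a b c d e sb (ca , cb , ab , dc , ec , de)) with InRange-occ5 al sb
... | ra , rb , rc , rd , re =
  occ5 (complement n a) (complement n b) (complement n c) (complement n d) (complement n e) (Sub-map⁺ (complement n) sb)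
    ((complement-reverses-< n (InRange⇒≤suc ra) ca , complement-reverses-< n (InRange⇒≤suc rb) cb , (λ x → ab (complement-injective n (InRange⇒≤suc ra) (InRange⇒≤suc rb) x))) ,
     complement-reverses-< n (InRange⇒≤suc rc) dc , complement-reverses-< n (InRange⇒≤suc rc) ec , (λ x → de (complement-injective n (InRange⇒≤suc rd) (InRange⇒≤suc re) x)))

OccA-complement⇒Occ₁ : ∀ n π → All (InRange n) π → Occ5 (Sem τA keyA) (complementPerm n π) → Occ5 Sem₁ π
OccA-complement⇒Occ₁ n π al (occ5 A B C D E sb' ((AC , BC , AB) , CD , CE , DE)) with Sub-map⁻ (complement n) π sb'
... | a ∷ b ∷ c ∷ d ∷ e ∷ [] , sb , refl with InRange-occ5 al sb
... | ra , rb , rc , rd , re =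
  occ5 a b c d e sb (complement-reverses-<⁻ n (InRange⇒≤suc rc) AC , complement-reverses-<⁻ n (InRange⇒≤suc rc) BC , (λ x → AB (cong (complement n) x)) ,
    complement-reverses-<⁻ n (InRange⇒≤suc rd) CD , complement-reverses-<⁻ n (InRange⇒≤suc re) CE , (λ x → DE (cong (complement n) x)))

false⇔false⇒≡ : ∀ (a b : Bool) → (a ≡ false → b ≡ false) → (b ≡ false → a ≡ false) → a ≡ b
false⇔false⇒≡ true true _ _ = refl
false⇔false⇒≡ false false _ _ = refl
false⇔false⇒≡ true false _ h = h refl
false⇔false⇒≡ false true h _ = sym (h refl)

avoidsAll-complement : ∀ n π → All (InRange n) π → avoidsAll pats₁ π ≡ avoidsAll pats₁ᶜ (complementPerm n π)
avoidsAll-complement n π al = false⇔false⇒≡ _ _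
  (λ e → OccA⇒¬avoidsA (Occ₁⇒OccA-complement n π al (avoidsAll-false⇒Occ5 pats₁ π decodes₁ e)))
  (λ e → Occ₁⇒¬avoids₁ (OccA-complement⇒Occ₁ n π al (avoidsAll-false⇒Occ5 pats₁ᶜ (complementPerm n π) decodesA e)))

coeff-filter : ∀ (st : List ℕ → ℕ) (p : List ℕ → Bool) (xs : List (List ℕ)) k → coeff st (filterᵇ p xs) k ≡ length (filterᵇ (λ x → p x ∧ (st x ≡ᵇ k)) xs)
coeff-filter st p [] k = refl
coeff-filter st p (x ∷ xs) k with p x
... | false = coeff-filter st p xs k
... | true with st x ≡ᵇ k
... | true = cong suc (coeff-filter st p xs k)
... | false = coeff-filter st p xs k

length-filter-map : ∀ (p : List ℕ → Bool) (f : List ℕ → List ℕ) (xs : List (List ℕ)) → length (filterᵇ p (map f xs)) ≡ length (filterᵇ (λ x → p (f x)) xs)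
length-filter-map p f [] = refl
length-filter-map p f (x ∷ xs) with p (f x)
... | true = cong suc (length-filter-map p f xs)
... | false = length-filter-map p f xs

length-filter-cong : ∀ {Q : List ℕ → Set} (p q : List ℕ → Bool) (xs : List (List ℕ)) → All Q xs → (∀ x → Q x → p x ≡ q x) → length (filterᵇ p xs) ≡ length (filterᵇ q xs)
length-filter-cong p q [] [] h = refl
length-filter-cong p q (x ∷ xs) (qx ∷ a) h with p x | q x | h x qx
... | true | true | refl = cong suc (length-filter-cong p q xs a h)
... | false | false | refl = length-filter-cong p q xs a h

coeff-rlmin-complement : ∀ n k → coeff rlmin (Av n pats₁) k ≡ coeff rlmax (Av n pats₁ᶜ) k
coeff-rlmin-complement n k = begin
  coeff rlmin (filterᵇ (avoidsAll pats₁) (perms n)) k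
    ≡⟨ coeff-filter rlmin (avoidsAll pats₁) (perms n) k ⟩
  length (filterᵇ counted₁ (perms n))
    ≡⟨ length-filter-cong counted₁ (countedᶜ ∘ complementPerm n) (perms n) (All-range-perms n) complement-counted ⟩
  length (filterᵇ (countedᶜ ∘ complementPerm n) (perms n))
    ≡⟨ sym (length-filter-map countedᶜ (complementPerm n) (perms n)) ⟩
  length (filterᵇ countedᶜ (map (complementPerm n) (perms n)))
    ≡⟨ ↭-length (filter-↭ (T? ∘ countedᶜ) (complement-↭ n)) ⟩
  length (filterᵇ countedᶜ (perms n))
    ≡⟨ sym (coeff-filter rlmax (avoidsAll pats₁ᶜ) (perms n) k) ⟩
  coeff rlmax (filterᵇ (avoidsAll pats₁ᶜ) (perms n)) k ∎
  where
  counted₁ countedᶜ : List ℕ → Bool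
  counted₁ π = avoidsAll pats₁ π ∧ (rlmin π ≡ᵇ k)
  countedᶜ π = avoidsAll pats₁ᶜ π ∧ (rlmax π ≡ᵇ k)
  complement-counted : ∀ π → All (InRange n) π → counted₁ π ≡ countedᶜ (complementPerm n π)
  complement-counted π r = cong₂ _∧_ (avoidsAll-complement n π r) (cong (_≡ᵇ k) (sym (rlmax-complement n π r)))

rlmin≤length : ∀ π → rlmin π ≤ length π
rlmin≤length [] = z≤n
rlmin≤length (x ∷ π) = go (all (x <ᵇ_) π)
  where
  go : ∀ b → (if b then 1 else 0) + rlmin π ≤ suc (length π)
  go true = s≤s (rlmin≤length π)
  go false = m≤n⇒m≤1+n (rlmin≤length π)

rlmax≤length : ∀ π → rlmax π ≤ length π
rlmax≤length [] = z≤n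
rlmax≤length (x ∷ π) = go (all (_<ᵇ x) π)
  where
  go : ∀ b → (if b then 1 else 0) + rlmax π ≤ suc (length π)
  go true = s≤s (rlmax≤length π)
  go false = m≤n⇒m≤1+n (rlmax≤length π)

Σ-indicator : ∀ B x → x ≤ B → Σ< (suc B) (λ k → if x ≡ᵇ k then 1 else 0) ≡ 1
Σ-indicator B zero _ = cong suc (Σ-zero B _ (λ i _ → refl))
Σ-indicator (suc B) (suc x) (s≤s p) = Σ-indicator B x p

length≡Σcoeff : ∀ (st : List ℕ → ℕ) B (L : List (List ℕ)) → All (λ π → st π ≤ B) L → length L ≡ Σ< (suc B) (coeff st L)
length≡Σcoeff st B [] [] = sym (Σ-zero (suc B) _ (λ _ _ → refl))
length≡Σcoeff st B (π ∷ L) (p ∷ a) = begin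
  suc (length L)
    ≡⟨ cong suc (length≡Σcoeff st B L a) ⟩
  1 + Σ< (suc B) (coeff st L)
    ≡⟨ cong (_+ Σ< (suc B) (coeff st L)) (sym (Σ-indicator B (st π) p)) ⟩
  Σ< (suc B) (λ k → if st π ≡ᵇ k then 1 else 0) + Σ< (suc B) (coeff st L)
    ≡⟨ sym (Σ-+ (suc B) (λ k → if st π ≡ᵇ k then 1 else 0) (coeff st L)) ⟩
  Σ< (suc B) (λ k → (if st π ≡ᵇ k then 1 else 0) + coeff st L k)
    ≡⟨ Σ-cong (suc B) _ _ (λ k _ → sym (coeff-∷ st π L k)) ⟩
  Σ< (suc B) (coeff st (π ∷ L)) ∎

All-≤-Av : ∀ n pats (st : List ℕ → ℕ) → (∀ π → st π ≤ length π) → All (λ π → st π ≤ n) (Av n pats)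
All-≤-Av n pats st st≤length =
  filter⁺ (T? ∘ avoidsAll pats) (All.map (λ {π} e → subst (st π ≤_) e (st≤length π)) (All-length-perms n))

proposition4p4 : (n : ℕ) → 1 ≤ n →
    ((k : ℕ) → coeff rlmin (Av n pats₁) k ≡ coeff rlmax (Av n pats₂) k)
    × (length (Av n pats₁) ≡ length (Av n pats₂))
proposition4p4 n 1≤n = same-coeff , same-length
  where
  same-coeff : (k : ℕ) → coeff rlmin (Av n pats₁) k ≡ coeff rlmax (Av n pats₂) k
  same-coeff k = trans (coeff-rlmin-complement n k) (equidistributed-rlmax n 1≤n k)
  same-length : length (Av n pats₁) ≡ length (Av n pats₂)
  same-length = begin
    length (Av n pats₁)
      ≡⟨ length≡Σcoeff rlmin n (Av n pats₁) (All-≤-Av n pats₁ rlmin rlmin≤length) ⟩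
    Σ< (suc n) (coeff rlmin (Av n pats₁))
      ≡⟨ Σ-cong (suc n) _ _ (λ k _ → same-coeff k) ⟩
    Σ< (suc n) (coeff rlmax (Av n pats₂))
      ≡⟨ sym (length≡Σcoeff rlmax n (Av n pats₂) (All-≤-Av n pats₂ rlmax rlmax≤length)) ⟩
    length (Av n pats₂) ∎
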